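{- Let $\sigma$ be a uniformly random permutation in $S_n$. Then, with probability tending to $1$ as $n\to\infty$, there is no integer $l>\log^3 n$ which divides the lengths of two distinct cycles of $\sigma$.
   Context: $\log$ denotes the natural logarithm; the cycles of $\sigma$ are those in its decomposition into disjoint cycles (including fixed points as cycles of length 1). -}

module Defs where

open import Data.Nat using (ℕ; zero; suc; _+_; _*_; _^_; _≤_; _<_)
open import Data.Nat.Divisibility using (_∣_)
open import Data.Fin using (Fin)
open import Data.Fin.Permutation using (Permutation′; _⟨$⟩ʳ_)
open import Data.Product using (Σ; ∃; _×_)
open import Relation.Binary.PropositionalEquality using (_≡_; _≢_)
open import Relation.Nullary using (¬_)

iter : ∀ {n} → Permutation′ n → ℕ → Fin n → Fin n
iter σ zero    i = i
iter σ (suc m) i = σ ⟨$⟩ʳ iter σ m i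

CycleLength : ∀ {n} → Permutation′ n → Fin n → ℕ → Set
CycleLength σ i k =
  1 ≤ k × iter σ k i ≡ i × (∀ m → 1 ≤ m → m < k → iter σ m i ≢ i)

DifferentCycles : ∀ {n} → Permutation′ n → Fin n → Fin n → Set
DifferentCycles σ i j = ∀ m → iter σ m i ≢ j

-- LogCubeLt n l  encodes  (log n)^3 < l  (natural log), n ≥ 1, via:
-- there is a rational q = a/(c+1) ≥ 0 with q^3 < l and n < e^q, where
-- n < e^q is witnessed by n < (1 + q/(k+1))^(k+1) for some k
-- (these quantities increase strictly to e^q).
-- Cleared of denominators (d = c+1, K = k+1):
--   a^3 < l * d^3   and   n * (K*d)^K < (K*d + a)^K.
LogCubeLt : ℕ → ℕ → Set
LogCubeLt n l =
  Σ ℕ λ a → Σ ℕ λ c → Σ ℕ λ k →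
    (a ^ 3 < l * (suc c) ^ 3) ×
    (n * (suc k * suc c) ^ suc k < (suc k * suc c + a) ^ suc k)

Bad : ∀ n → Permutation′ n → Set
Bad n σ =
  Σ ℕ λ l → LogCubeLt n l ×
    (Σ (Fin n) λ i → Σ (Fin n) λ j → Σ ℕ λ k₁ → Σ ℕ λ k₂ →
       CycleLength σ i k₁ × CycleLength σ j k₂ ×
       DifferentCycles σ i j × l ∣ k₁ × l ∣ k₂)

Distinct : ∀ {n} → Permutation′ n → Permutation′ n → Set
Distinct σ τ = ¬ (∀ i → σ ⟨$⟩ʳ i ≡ τ ⟨$⟩ʳ i)

{-# OPTIONS --safe #-}
-- A first-moment argument. Build each permutation of n + 1 points from one of n points
-- by inserting the new point either as a fixed point or right after one of the old
-- points (the Chinese restaurant construction). Tracking how cycle lengths change gives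
-- recurrences showing that, summed over the symmetric group S_n, the number of ordered
-- pairs (x, y) lying on distinct cycles of lengths k₁ and k₂ is at most n!.
-- A bad σ, with l > log³ n dividing the lengths a·l and c·l of two distinct cycles, has
-- at least (a·l)(c·l) such pairs for k₁ = a·l, k₂ = c·l. Weight these counts by dyadic
-- versions of 2^S/a, 2^S/c and 4^S/l², where S = ⌊log₂ n⌋ and only l ≥ 2^U count; U ≈ 3 log₂ S
-- is chosen so that 2^U < l whenever l > log³ n. Every bad σ then has weight at least 16^S,
-- while the total weight over S_n is at most 2(S+2)²·16^S·n!/2^U, so bad permutations make
-- up a fraction O(S²/2^U) = O(1/log n).
module Submission where

open import Defs
open import Data.Nat using (ℕ; zero; suc; _+_; _*_; _∸_; _^_; _≤_; _<_; z≤n; s≤s; s≤s⁻¹; _≟_; _≤?_; _!; NonZero; >-nonZero; >-nonZero⁻¹)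
open import Data.Nat.Properties
open import Data.Nat.DivMod using (_%_; _/_; m≡m%n+[m/n]*n; m%n<n; m/n*n≤m)
open import Data.Nat.Divisibility using (divides)
open import Data.Nat.Induction using (<-rec)
open import Data.Nat.ListAction using (sum)
open import Data.Nat.Tactic.RingSolver using (solve-∀)
open import Data.Bool using (if_then_else_)
open import Data.Empty using (⊥-elim)
open import Data.Fin using (Fin; zero; suc; toℕ; fromℕ<; punchIn)
import Data.Fin.Properties as F
import Data.Fin.Permutation.Components as PC
open import Data.Fin.Permutation using (Permutation′; _⟨$⟩ʳ_; _⟨$⟩ˡ_; _≈_; _∘ₚ_; id; lift₀; transpose; remove; flip; inverseˡ; inverseʳ)
open import Data.List using (List; []; _∷_; map; length)
open import Data.List.Relation.Unary.All as All using (All; []; _∷_)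
open import Data.List.Relation.Unary.AllPairs using (AllPairs; []; _∷_)
open import Data.Product using (Σ; ∃; _×_; _,_; proj₁; proj₂; uncurry)
open import Function using (_∘_; _⇔_; mk⇔; Equivalence)
open import Relation.Binary.Definitions using (tri<; tri≈; tri>)
open import Relation.Binary.PropositionalEquality
open import Relation.Nullary using (¬_; Dec; yes; no; does; map′; _×-dec_; ¬?; contradiction)
open import Relation.Nullary.Decidable using (dec-true; dec-false)
open import Relation.Unary using (Pred; Decidable)
open import Algebra.Properties.Semiring.Sum +-*-semiring
  using (sum-syntax; ∑-distrib-+; ∑-comm; sum-cong-≗; sum-init-last; *-distribˡ-sum; *-distribʳ-sum)

𝟙 : ∀ {a} {A : Set a} → Dec A → ℕ
𝟙 a? = if does a? then 1 else 0

module _ {a} {A : Set a} where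

  𝟙-yes : (a? : Dec A) → A → 𝟙 a? ≡ 1
  𝟙-yes a? x rewrite dec-true a? x = refl

  𝟙-no : (a? : Dec A) → ¬ A → 𝟙 a? ≡ 0
  𝟙-no a? ¬x rewrite dec-false a? ¬x = refl

  𝟙-≤-1 : (a? : Dec A) → 𝟙 a? ≤ 1
  𝟙-≤-1 (yes _) = s≤s z≤n
  𝟙-≤-1 (no _)  = z≤n

  𝟙-+-𝟙-¬ : (a? : Dec A) → 𝟙 a? + 𝟙 (¬? a?) ≡ 1
  𝟙-+-𝟙-¬ (yes _) = refl
  𝟙-+-𝟙-¬ (no _)  = refl

𝟙-mono : ∀ {a b} {A : Set a} {B : Set b} (a? : Dec A) (b? : Dec B) → (A → B) → 𝟙 a? ≤ 𝟙 b?
𝟙-mono (no _)  _   _   = z≤n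
𝟙-mono (yes x) b? A→B = ≤-reflexive (sym (𝟙-yes b? (A→B x)))

𝟙-cong : ∀ {a b} {A : Set a} {B : Set b} (a? : Dec A) (b? : Dec B) → (A → B) → (B → A) → 𝟙 a? ≡ 𝟙 b?
𝟙-cong a? b? A→B B→A = ≤-antisym (𝟙-mono a? b? A→B) (𝟙-mono b? a? B→A)

∑-mono-≤ : ∀ {n} {f g : Fin n → ℕ} → (∀ i → f i ≤ g i) → ∑[ i < n ] f i ≤ ∑[ i < n ] g i
∑-mono-≤ {zero}  f≤g = z≤n
∑-mono-≤ {suc n} {f} {g} f≤g = +-mono-≤ (f≤g zero) (∑-mono-≤ {f = f ∘ suc} {g = g ∘ suc} (f≤g ∘ suc))

∑-const : ∀ n c → ∑[ i < n ] c ≡ n * c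
∑-const zero    c = refl
∑-const (suc n) c = cong (c +_) (∑-const n c)

∑-zero : ∀ {n} {f : Fin n → ℕ} → (∀ i → f i ≡ 0) → ∑[ i < n ] f i ≡ 0
∑-zero {n} f≡0 = trans (sum-cong-≗ f≡0) (trans (∑-const n 0) (*-zeroʳ n))

term≤∑ : ∀ {n} (f : Fin n → ℕ) i → f i ≤ ∑[ j < n ] f j
term≤∑ f zero    = m≤m+n _ _
term≤∑ f (suc i) = ≤-trans (term≤∑ (f ∘ suc) i) (m≤n+m _ _)

∑-𝟙-≟ : ∀ {n} (j : Fin n) → ∑[ i < n ] 𝟙 (j F.≟ i) ≡ 1
∑-𝟙-≟ {suc n} zero    = cong suc (∑-zero {n} λ _ → refl)
∑-𝟙-≟         (suc j) = ∑-𝟙-≟ j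

∑-toℕ-+ : ∀ m k (f : ℕ → ℕ) →
  ∑[ i < m + k ] f (toℕ i) ≡ ∑[ i < m ] f (toℕ i) + ∑[ i < k ] f (m + toℕ i)
∑-toℕ-+ zero    k f = refl
∑-toℕ-+ (suc m) k f = trans (cong (f 0 +_) (∑-toℕ-+ m k (f ∘ suc))) (sym (+-assoc (f 0) _ _))

∑-toℕ-mono : ∀ {m m′} (f : ℕ → ℕ) → m ≤ m′ → ∑[ i < m ] f (toℕ i) ≤ ∑[ i < m′ ] f (toℕ i)
∑-toℕ-mono {m} {m′} f m≤m′ = begin
  ∑[ i < m ] f (toℕ i)                                            ≤⟨ m≤m+n _ _ ⟩
  ∑[ i < m ] f (toℕ i) + ∑[ t < m′ ∸ m ] f (m + toℕ t)           ≡⟨ ∑-toℕ-+ m (m′ ∸ m) f ⟨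
  ∑[ i < m + (m′ ∸ m) ] f (toℕ i)                                 ≡⟨ cong (λ k → ∑[ i < k ] f (toℕ i)) (m+[n∸m]≡n m≤m′) ⟩
  ∑[ i < m′ ] f (toℕ i)                                           ∎
  where open ≤-Reasoning

term≤∑-toℕ : ∀ {m} (f : ℕ → ℕ) {i} → i < m → f i ≤ ∑[ j < m ] f (toℕ j)
term≤∑-toℕ f i<m = subst (λ k → f k ≤ _) (F.toℕ-fromℕ< i<m) (term≤∑ (f ∘ toℕ) (fromℕ< i<m))

module _ {n p} {P : Pred (Fin n) p} (P? : Decidable P) where

  ∑-𝟙-split : (F : ℕ → ℕ) →
    ∑[ i < n ] F (𝟙 (P? i)) ≡ F 1 * ∑[ i < n ] 𝟙 (P? i) + F 0 * ∑[ i < n ] 𝟙 (¬? (P? i))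
  ∑-𝟙-split F = begin
    ∑[ i < n ] F (𝟙 (P? i))                                    ≡⟨ sum-cong-≗ (λ i → pointwise (P? i)) ⟩
    ∑[ i < n ] (F 1 * 𝟙 (P? i) + F 0 * 𝟙 (¬? (P? i)))           ≡⟨ ∑-distrib-+ (λ i → F 1 * 𝟙 (P? i)) (λ i → F 0 * 𝟙 (¬? (P? i))) ⟩
    ∑[ i < n ] (F 1 * 𝟙 (P? i)) + ∑[ i < n ] (F 0 * 𝟙 (¬? (P? i)))  ≡⟨ cong₂ _+_ (*-distribˡ-sum (F 1) (𝟙 ∘ P?))
                                                                                (*-distribˡ-sum (F 0) (𝟙 ∘ ¬? ∘ P?)) ⟨
    F 1 * ∑[ i < n ] 𝟙 (P? i) + F 0 * ∑[ i < n ] 𝟙 (¬? (P? i))  ∎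
    where
    open ≡-Reasoning
    pointwise : ∀ {A : Set p} (a? : Dec A) → F (𝟙 a?) ≡ F 1 * 𝟙 a? + F 0 * 𝟙 (¬? a?)
    pointwise (yes _) = sym (trans (cong₂ _+_ (*-identityʳ (F 1)) (*-zeroʳ (F 0))) (+-identityʳ (F 1)))
    pointwise (no _)  = sym (cong₂ _+_ (*-zeroʳ (F 1)) (*-identityʳ (F 0)))

  module _ {q} {Q : Pred (Fin n) q} (Q? : Decidable Q) (disjoint : ∀ i → P i → ¬ Q i) where

    ∑-𝟙-split₂ : (F : ℕ → ℕ → ℕ) →
      ∑[ i < n ] F (𝟙 (P? i)) (𝟙 (Q? i)) ≡
      F 1 0 * ∑[ i < n ] 𝟙 (P? i) + F 0 1 * ∑[ i < n ] 𝟙 (Q? i) + F 0 0 * ∑[ i < n ] 𝟙 (¬? (P? i) ×-dec ¬? (Q? i))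
    ∑-𝟙-split₂ F = begin
      ∑[ i < n ] F (𝟙 (P? i)) (𝟙 (Q? i))
        ≡⟨ sum-cong-≗ (λ i → pointwise (P? i) (Q? i) (disjoint i)) ⟩
      ∑[ i < n ] (F 1 0 * 𝟙 (P? i) + F 0 1 * 𝟙 (Q? i) + F 0 0 * 𝟙 (¬? (P? i) ×-dec ¬? (Q? i)))
        ≡⟨ trans (∑-distrib-+ (λ i → F 1 0 * 𝟙 (P? i) + F 0 1 * 𝟙 (Q? i)) (λ i → F 0 0 * 𝟙 (¬? (P? i) ×-dec ¬? (Q? i))))
                 (cong (_+ ∑[ i < n ] (F 0 0 * 𝟙 (¬? (P? i) ×-dec ¬? (Q? i)))) (∑-distrib-+ (λ i → F 1 0 * 𝟙 (P? i)) (λ i → F 0 1 * 𝟙 (Q? i)))) ⟩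
      ∑[ i < n ] (F 1 0 * 𝟙 (P? i)) + ∑[ i < n ] (F 0 1 * 𝟙 (Q? i)) + ∑[ i < n ] (F 0 0 * 𝟙 (¬? (P? i) ×-dec ¬? (Q? i)))
        ≡⟨ sym (cong₂ _+_ (cong₂ _+_ (*-distribˡ-sum (F 1 0) (𝟙 ∘ P?)) (*-distribˡ-sum (F 0 1) (𝟙 ∘ Q?)))
                           (*-distribˡ-sum (F 0 0) (λ i → 𝟙 (¬? (P? i) ×-dec ¬? (Q? i))))) ⟩
      F 1 0 * ∑[ i < n ] 𝟙 (P? i) + F 0 1 * ∑[ i < n ] 𝟙 (Q? i) + F 0 0 * ∑[ i < n ] 𝟙 (¬? (P? i) ×-dec ¬? (Q? i)) ∎
      where
      open ≡-Reasoning
      pointwise : ∀ {A : Set p} {B : Set q} (a? : Dec A) (b? : Dec B) → (A → ¬ B) →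
        F (𝟙 a?) (𝟙 b?) ≡ F 1 0 * 𝟙 a? + F 0 1 * 𝟙 b? + F 0 0 * 𝟙 (¬? a? ×-dec ¬? b?)
      pointwise (yes a) (yes b) a⇒¬b = ⊥-elim (a⇒¬b a b)
      pointwise (yes _) (no _)  _ = e₁ (F 1 0) (F 0 1) (F 0 0)
        where e₁ : ∀ x y z → x ≡ x * 1 + y * 0 + z * 0
              e₁ = solve-∀
      pointwise (no _)  (yes _) _ = e₂ (F 1 0) (F 0 1) (F 0 0)
        where e₂ : ∀ x y z → y ≡ x * 0 + y * 1 + z * 0
              e₂ = solve-∀
      pointwise (no _)  (no _)  _ = e₃ (F 1 0) (F 0 1) (F 0 0)
        where e₃ : ∀ x y z → z ≡ x * 0 + y * 0 + z * 1
              e₃ = solve-∀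

minimal : ∀ {p} {P : Pred ℕ p} → Decidable P → ∀ {k} → P k → ∃ λ m → P m × (∀ {j} → j < m → ¬ P j)
minimal {P = P} P? {k} = <-rec (λ k → P k → ∃ λ m → P m × (∀ {j} → j < m → ¬ P j)) search k
  where
  search : ∀ k → (∀ {j} → j < k → P j → ∃ λ m → P m × (∀ {j} → j < m → ¬ P j)) → P k → _
  search k below Pk with anyUpTo? P? k
  ... | yes (j , j<k , Pj) = below j<k Pj
  ... | no  none           = k , Pk , λ j<k Pj → none (_ , j<k , Pj)

module _ {p} {P : Pred ℕ p} (P? : Decidable P) where

  𝟙-anyUpTo?-suc : ∀ v → ¬ (P v × ∃ λ t → t < v × P t) →
    𝟙 (anyUpTo? P? (suc v)) ≡ 𝟙 (P? v) + 𝟙 (anyUpTo? P? v)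
  𝟙-anyUpTo?-suc v exclusive with P? v | anyUpTo? P? v
  ... | yes Pv | yes ∃P = ⊥-elim (exclusive (Pv , ∃P))
  ... | yes _  | no  _  = refl
  ... | no  _  | yes _  = refl
  ... | no  _  | no  _  = refl

∑-𝟙-image : ∀ {n} c (g : ℕ → Fin n) → (∀ {s t} → s < c → t < c → g s ≡ g t → s ≡ t) →
  ∑[ i < n ] 𝟙 (anyUpTo? (λ t → g t F.≟ i) c) ≡ c
∑-𝟙-image {n} zero g _   = ∑-zero {n} (λ _ → refl)
∑-𝟙-image {n} (suc c) g inj = begin
  ∑[ i < n ] 𝟙 (anyUpTo? (λ t → g t F.≟ i) (suc c))
    ≡⟨ sum-cong-≗ (λ i → 𝟙-anyUpTo?-suc (λ t → g t F.≟ i) c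
         λ { (refl , t , t<c , gt≡gc) → <-irrefl (inj (m<n⇒m<1+n t<c) ≤-refl gt≡gc) t<c }) ⟩
  ∑[ i < n ] (𝟙 (g c F.≟ i) + 𝟙 (anyUpTo? (λ t → g t F.≟ i) c))
    ≡⟨ ∑-distrib-+ (λ i → 𝟙 (g c F.≟ i)) (λ i → 𝟙 (anyUpTo? (λ t → g t F.≟ i) c)) ⟩
  ∑[ i < n ] 𝟙 (g c F.≟ i) + ∑[ i < n ] 𝟙 (anyUpTo? (λ t → g t F.≟ i) c)
    ≡⟨ cong₂ _+_ (∑-𝟙-≟ (g c)) (∑-𝟙-image c g λ s<c t<c → inj (m<n⇒m<1+n s<c) (m<n⇒m<1+n t<c)) ⟩
  suc c ∎
  where open ≡-Reasoning

∑-𝟙-+-∑-𝟙-¬ : ∀ {n p} {P : Pred (Fin n) p} (P? : Decidable P) → ∑[ i < n ] 𝟙 (P? i) + ∑[ i < n ] 𝟙 (¬? (P? i)) ≡ n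
∑-𝟙-+-∑-𝟙-¬ {n} P? = trans (sym (∑-distrib-+ (𝟙 ∘ P?) (𝟙 ∘ ¬? ∘ P?)))
  (trans (sum-cong-≗ (λ i → 𝟙-+-𝟙-¬ (P? i))) (trans (∑-const n 1) (*-identityʳ n)))

∑₂-linear₃ : ∀ {m n} (f g h : Fin m → Fin n → ℕ) a b c →
  ∑[ i < m ] ∑[ j < n ] (f i j * a + g i j * b + h i j * c) ≡
  ∑[ i < m ] ∑[ j < n ] f i j * a + ∑[ i < m ] ∑[ j < n ] g i j * b + ∑[ i < m ] ∑[ j < n ] h i j * c
∑₂-linear₃ {m} {n} f g h a b c = begin
  ∑[ i < m ] ∑[ j < n ] (f i j * a + g i j * b + h i j * c)
    ≡⟨ sum-cong-≗ (λ i → trans (∑-distrib-+ (λ j → f i j * a + g i j * b) (λ j → h i j * c))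
                               (cong (_+ ∑[ j < n ] (h i j * c)) (∑-distrib-+ (λ j → f i j * a) (λ j → g i j * b)))) ⟩
  ∑[ i < m ] (∑[ j < n ] (f i j * a) + ∑[ j < n ] (g i j * b) + ∑[ j < n ] (h i j * c))
    ≡⟨ trans (∑-distrib-+ (λ i → ∑[ j < n ] (f i j * a) + ∑[ j < n ] (g i j * b)) (λ i → ∑[ j < n ] (h i j * c)))
             (cong (_+ ∑[ i < m ] ∑[ j < n ] (h i j * c)) (∑-distrib-+ (λ i → ∑[ j < n ] (f i j * a)) (λ i → ∑[ j < n ] (g i j * b)))) ⟩
  ∑[ i < m ] ∑[ j < n ] (f i j * a) + ∑[ i < m ] ∑[ j < n ] (g i j * b) + ∑[ i < m ] ∑[ j < n ] (h i j * c)
    ≡⟨ cong₂ _+_ (cong₂ _+_ (∑₂-*ʳ f a) (∑₂-*ʳ g b)) (∑₂-*ʳ h c) ⟩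
  ∑[ i < m ] ∑[ j < n ] f i j * a + ∑[ i < m ] ∑[ j < n ] g i j * b + ∑[ i < m ] ∑[ j < n ] h i j * c
    ∎
  where
  open ≡-Reasoning
  ∑₂-*ʳ : (f : Fin m → Fin n → ℕ) (a : ℕ) → ∑[ i < m ] ∑[ j < n ] (f i j * a) ≡ ∑[ i < m ] ∑[ j < n ] f i j * a
  ∑₂-*ʳ f a = trans (sum-cong-≗ (λ i → sym (*-distribʳ-sum a (f i)))) (sym (*-distribʳ-sum a (λ i → ∑[ j < n ] f i j)))

-- Cycles of a permutation

⟨$⟩ʳ-injective : ∀ {n} (σ : Permutation′ n) {i j} → σ ⟨$⟩ʳ i ≡ σ ⟨$⟩ʳ j → i ≡ j
⟨$⟩ʳ-injective σ eq = trans (sym (inverseˡ σ)) (trans (cong (σ ⟨$⟩ˡ_) eq) (inverseˡ σ))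

iter-cong : ∀ {n} {σ τ : Permutation′ n} → σ ≈ τ → ∀ m i → iter σ m i ≡ iter τ m i
iter-cong σ≈τ zero    i = refl
iter-cong {σ = σ} {τ} σ≈τ (suc m) i = trans (cong (σ ⟨$⟩ʳ_) (iter-cong σ≈τ m i)) (σ≈τ (iter τ m i))

CycleLength-resp-≈ : ∀ {n} {σ τ : Permutation′ n} → σ ≈ τ → ∀ {i k} → CycleLength σ i k → CycleLength τ i k
CycleLength-resp-≈ σ≈τ {i} {k} (k≥1 , ret , first) =
  k≥1 , trans (sym (iter-cong σ≈τ k i)) ret , λ m 1≤m m<k → first m 1≤m m<k ∘ trans (iter-cong σ≈τ m i)

module _ {n} (σ : Permutation′ n) where

  iter-+ : ∀ m k i → iter σ (m + k) i ≡ iter σ m (iter σ k i)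
  iter-+ zero    k i = refl
  iter-+ (suc m) k i = cong (σ ⟨$⟩ʳ_) (iter-+ m k i)

  iter-suc : ∀ m i → iter σ (suc m) i ≡ iter σ m (σ ⟨$⟩ʳ i)
  iter-suc m i = trans (cong (λ t → iter σ t i) (+-comm 1 m)) (iter-+ m 1 i)

  iter-comm : ∀ m k i → iter σ m (iter σ k i) ≡ iter σ k (iter σ m i)
  iter-comm m k i = trans (sym (iter-+ m k i)) (trans (cong (λ t → iter σ t i) (+-comm m k)) (iter-+ k m i))

  iter-injective : ∀ m {i j} → iter σ m i ≡ iter σ m j → i ≡ j
  iter-injective zero    eq = eq
  iter-injective (suc m) eq = iter-injective m (⟨$⟩ʳ-injective σ eq)

  iter-*-period : ∀ {k i} → iter σ k i ≡ i → ∀ q → iter σ (q * k) i ≡ i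
  iter-*-period         ret zero    = refl
  iter-*-period {k} {i} ret (suc q) = trans (iter-+ k (q * k) i) (trans (cong (iter σ k) (iter-*-period ret q)) ret)

  iter-% : ∀ {k i} .{{_ : NonZero k}} → iter σ k i ≡ i → ∀ m → iter σ (m % k) i ≡ iter σ m i
  iter-% {k} {i} ret m = begin
    iter σ (m % k) i                       ≡⟨ cong (iter σ (m % k)) (iter-*-period ret (m / k)) ⟨
    iter σ (m % k) (iter σ (m / k * k) i)  ≡⟨ iter-+ (m % k) (m / k * k) i ⟨
    iter σ (m % k + m / k * k) i           ≡⟨ cong (λ t → iter σ t i) (m≡m%n+[m/n]*n m k) ⟨
    iter σ m i                             ∎
    where open ≡-Reasoning

  private
    returns : ∀ i → ∃ λ d → 1 ≤ d × iter σ d i ≡ i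
    returns i with F.pigeonhole (n<1+n n) (λ t → iter σ (toℕ t) i)
    ... | s , t , s<t , eq = toℕ t ∸ toℕ s , m<n⇒0<n∸m s<t , iter-injective (toℕ s) (begin
      iter σ (toℕ s) (iter σ (toℕ t ∸ toℕ s) i)  ≡⟨ iter-+ (toℕ s) (toℕ t ∸ toℕ s) i ⟨
      iter σ (toℕ s + (toℕ t ∸ toℕ s)) i         ≡⟨ cong (λ m → iter σ m i) (m+[n∸m]≡n (<⇒≤ s<t)) ⟩
      iter σ (toℕ t) i                           ≡⟨ eq ⟨
      iter σ (toℕ s) i                           ∎)
      where open ≡-Reasoning

  -- Opaque: only its specification is used, and unfolding the search makes type checking very slow.
  opaque
    cycleLength-exists : ∀ i → ∃ (CycleLength σ i)
    cycleLength-exists i with returns i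
    ... | d , d≥1 , ret with minimal (λ m → 1 ≤? m ×-dec iter σ m i F.≟ i) (d≥1 , ret)
    ... | k , (k≥1 , retₖ) , least = k , k≥1 , retₖ , λ m 1≤m m<k retₘ → least m<k (1≤m , retₘ)

  cycleLength : Fin n → ℕ
  cycleLength i = proj₁ (cycleLength-exists i)

  cycleLength-CycleLength : ∀ i → CycleLength σ i (cycleLength i)
  cycleLength-CycleLength i = proj₂ (cycleLength-exists i)

  CycleLength-unique : ∀ {i k k′} → CycleLength σ i k → CycleLength σ i k′ → k ≡ k′
  CycleLength-unique {k = k} {k′} (k≥1 , retₖ , firstₖ) (k′≥1 , retₖ′ , firstₖ′) with <-cmp k k′
  ... | tri< k<k′ _ _ = contradiction retₖ (firstₖ′ k k≥1 k<k′)
  ... | tri≈ _ k≡k′ _ = k≡k′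
  ... | tri> _ _ k′<k = contradiction retₖ′ (firstₖ k′ k′≥1 k′<k)

  CycleLength⇒≡ : ∀ {i k} → CycleLength σ i k → k ≡ cycleLength i
  CycleLength⇒≡ {i} cl = CycleLength-unique cl (cycleLength-CycleLength i)

  SameCycle : Fin n → Fin n → Set
  SameCycle i j = ∃ λ m → iter σ m i ≡ j

  private
    nonZero : ∀ i → NonZero (cycleLength i)
    nonZero i = >-nonZero (proj₁ (cycleLength-CycleLength i))

  SameCycle-within : ∀ {i j} → SameCycle i j → ∃ λ t → t < cycleLength i × iter σ t i ≡ j
  SameCycle-within {i} (m , refl) = m % cycleLength i , m%n<n m _ ,
    iter-% (proj₁ (proj₂ (cycleLength-CycleLength i))) m
    where instance _ = nonZero i

  sameCycle? : ∀ i j → Dec (SameCycle i j)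
  sameCycle? i j = map′ (λ (t , _ , eq) → t , eq) SameCycle-within
    (anyUpTo? (λ t → iter σ t i F.≟ j) (cycleLength i))

  differentCycles? : ∀ i j → Dec (DifferentCycles σ i j)
  differentCycles? i j = map′ (λ ¬same m eq → ¬same (m , eq)) (λ diff (m , eq) → diff m eq)
    (¬? (sameCycle? i j))

  SameCycle-trans : ∀ {i j k} → SameCycle i j → SameCycle j k → SameCycle i k
  SameCycle-trans {i} (m , refl) (m′ , refl) = m′ + m , iter-+ m′ m i

  SameCycle-sym : ∀ {i j} → SameCycle i j → SameCycle j i
  SameCycle-sym {i} same with SameCycle-within same
  ... | t , t<c , refl = cycleLength i ∸ t , (begin
    iter σ (cycleLength i ∸ t) (iter σ t i)  ≡⟨ iter-+ (cycleLength i ∸ t) t i ⟨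
    iter σ (cycleLength i ∸ t + t) i         ≡⟨ cong (λ m → iter σ m i) (m∸n+n≡m (<⇒≤ t<c)) ⟩
    iter σ (cycleLength i) i                 ≡⟨ proj₁ (proj₂ (cycleLength-CycleLength i)) ⟩
    i                                        ∎)
    where open ≡-Reasoning

  DifferentCycles-sym : ∀ {i j} → DifferentCycles σ i j → DifferentCycles σ j i
  DifferentCycles-sym diff m eq = uncurry diff (SameCycle-sym (m , eq))

  CycleLength-resp-SameCycle : ∀ {i j k} → SameCycle i j → CycleLength σ i k → CycleLength σ j k
  CycleLength-resp-SameCycle {i} {k = k} (m , refl) (k≥1 , ret , first) =
    k≥1 , trans (iter-comm k m i) (cong (iter σ m) ret) ,
    λ m′ 1≤m′ m′<k ret′ → first m′ 1≤m′ m′<k (iter-injective m (trans (iter-comm m m′ i) ret′))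

  cycleLength-resp-SameCycle : ∀ {i j} → SameCycle i j → cycleLength j ≡ cycleLength i
  cycleLength-resp-SameCycle {i} same = sym (CycleLength⇒≡ (CycleLength-resp-SameCycle same (cycleLength-CycleLength i)))

  private
    iter-<-injective : ∀ {i c s t} → CycleLength σ i c → s < t → t < c → iter σ s i ≢ iter σ t i
    iter-<-injective {i} {s = s} {t} (_ , _ , first) s<t t<c eq =
      first (t ∸ s) (m<n⇒0<n∸m s<t) (≤-<-trans (m∸n≤m t s) t<c) (iter-injective s (begin
        iter σ s (iter σ (t ∸ s) i)  ≡⟨ iter-+ s (t ∸ s) i ⟨
        iter σ (s + (t ∸ s)) i       ≡⟨ cong (λ m → iter σ m i) (m+[n∸m]≡n (<⇒≤ s<t)) ⟩
        iter σ t i                   ≡⟨ eq ⟨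
        iter σ s i                   ∎))
      where open ≡-Reasoning

  ∑-𝟙-sameCycle : ∀ i → ∑[ j < n ] 𝟙 (sameCycle? i j) ≡ cycleLength i
  ∑-𝟙-sameCycle i = ∑-𝟙-image (cycleLength i) (λ t → iter σ t i) injective
    where
    cl = cycleLength-CycleLength i
    injective : ∀ {s t} → s < cycleLength i → t < cycleLength i → iter σ s i ≡ iter σ t i → s ≡ t
    injective {s} {t} s<c t<c eq with <-cmp s t
    ... | tri< s<t _ _ = contradiction eq (iter-<-injective cl s<t t<c)
    ... | tri≈ _ s≡t _ = s≡t
    ... | tri> _ _ t<s = contradiction (sym eq) (iter-<-injective cl t<s s<c)

  cycleLength≤n : ∀ i → cycleLength i ≤ n
  cycleLength≤n i = begin
    cycleLength i                  ≡⟨ ∑-𝟙-sameCycle i ⟨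
    ∑[ j < n ] 𝟙 (sameCycle? i j)  ≤⟨ ∑-mono-≤ (λ j → 𝟙-≤-1 (sameCycle? i j)) ⟩
    ∑[ j < n ] 1                   ≡⟨ trans (∑-const n 1) (*-identityʳ n) ⟩
    n                              ∎
    where open ≤-Reasoning

  cycleLength-+-≤n : ∀ {i j} → DifferentCycles σ i j → cycleLength i + cycleLength j ≤ n
  cycleLength-+-≤n {i} {j} diff = begin
    cycleLength i + cycleLength j                                 ≡⟨ cong₂ _+_ (∑-𝟙-sameCycle i) (∑-𝟙-sameCycle j) ⟨
    ∑[ k < n ] 𝟙 (sameCycle? i k) + ∑[ k < n ] 𝟙 (sameCycle? j k)  ≡⟨ ∑-distrib-+ (𝟙 ∘ sameCycle? i) (𝟙 ∘ sameCycle? j) ⟨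
    ∑[ k < n ] (𝟙 (sameCycle? i k) + 𝟙 (sameCycle? j k))          ≤⟨ ∑-mono-≤ (λ k → atMostOne (sameCycle? i k) (sameCycle? j k)) ⟩
    ∑[ k < n ] 1                                                  ≡⟨ trans (∑-const n 1) (*-identityʳ n) ⟩
    n                                                             ∎
    where
    open ≤-Reasoning
    atMostOne : ∀ {k} (a? : Dec (SameCycle i k)) (b? : Dec (SameCycle j k)) → 𝟙 a? + 𝟙 b? ≤ 1
    atMostOne (yes ik) (yes jk) = contradiction (SameCycle-trans ik (SameCycle-sym jk)) λ (m , eq) → diff m eq
    atMostOne (yes _)  (no _)   = s≤s z≤n
    atMostOne (no _)   b?       = 𝟙-≤-1 b?

cycleLength-resp-≈ : ∀ {n} {σ τ : Permutation′ n} → σ ≈ τ → ∀ i → cycleLength σ i ≡ cycleLength τ i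
cycleLength-resp-≈ {τ = τ} σ≈τ i = CycleLength⇒≡ τ (CycleLength-resp-≈ σ≈τ (cycleLength-CycleLength _ i))

DifferentCycles-resp-≈ : ∀ {n} {σ τ : Permutation′ n} → σ ≈ τ → ∀ {i j} → DifferentCycles σ i j → DifferentCycles τ i j
DifferentCycles-resp-≈ σ≈τ {i} diff m = diff m ∘ trans (iter-cong σ≈τ m i)

-- Inserting a new point

LiftsOrbit : ∀ {n} → Permutation′ (suc n) → Permutation′ n → Fin n → Set
LiftsOrbit τ ρ x = ∀ m → iter τ m (suc x) ≡ suc (iter ρ m x)

module _ {n} {τ : Permutation′ (suc n)} {ρ : Permutation′ n} {x : Fin n} (lifts : LiftsOrbit τ ρ x) where

  CycleLength-lift : ∀ {k} → CycleLength ρ x k → CycleLength τ (suc x) k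
  CycleLength-lift {k} (k≥1 , ret , first) =
    k≥1 , trans (lifts k) (cong suc ret) , λ m 1≤m m<k eq → first m 1≤m m<k (F.suc-injective (trans (sym (lifts m)) eq))

  cycleLength-lift : cycleLength τ (suc x) ≡ cycleLength ρ x
  cycleLength-lift = sym (CycleLength⇒≡ τ (CycleLength-lift (cycleLength-CycleLength ρ x)))

  SameCycle-lift : ∀ {y} → SameCycle τ (suc x) (suc y) ⇔ SameCycle ρ x y
  SameCycle-lift = mk⇔ (λ (m , eq) → m , F.suc-injective (trans (sym (lifts m)) eq))
                       (λ (m , eq) → m , trans (lifts m) (cong suc eq))

-- insert ρ p adds a new point zero to ρ, the old points being shifted by suc: as a fixed
-- point if p = zero, and right after q in its cycle if p = suc q.
insert : ∀ {n} → Permutation′ n → Fin (suc n) → Permutation′ (suc n)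
insert ρ p = transpose zero p ∘ₚ lift₀ ρ

module _ {n} (ρ : Permutation′ n) where

  insert-suc-self : ∀ q → insert ρ (suc q) ⟨$⟩ʳ suc q ≡ zero
  insert-suc-self q rewrite dec-true (q F.≟ q) refl = refl

  insert-suc-other : ∀ {q j} → j ≢ q → insert ρ (suc q) ⟨$⟩ʳ suc j ≡ suc (ρ ⟨$⟩ʳ j)
  insert-suc-other {q} {j} j≢q rewrite dec-false (j F.≟ q) j≢q = refl

  iter-insert-zero-zero : ∀ m → iter (insert ρ zero) m zero ≡ zero
  iter-insert-zero-zero zero    = refl
  iter-insert-zero-zero (suc m) = cong (insert ρ zero ⟨$⟩ʳ_) (iter-insert-zero-zero m)

  insert-zero-lifts : ∀ x → LiftsOrbit (insert ρ zero) ρ x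
  insert-zero-lifts x zero    = refl
  insert-zero-lifts x (suc m) = cong (insert ρ zero ⟨$⟩ʳ_) (insert-zero-lifts x m)

  cycleLength-insert-zero-zero : cycleLength (insert ρ zero) zero ≡ 1
  cycleLength-insert-zero-zero = sym (CycleLength⇒≡ (insert ρ zero) {zero} (s≤s z≤n , refl , λ { (suc m) _ (s≤s ()) }))

  ¬SameCycle-insert-zero : ∀ {y} → ¬ SameCycle (insert ρ zero) zero (suc y)
  ¬SameCycle-insert-zero (m , eq) with () ← trans (sym (iter-insert-zero-zero m)) eq

  module _ (q : Fin n) where

    private
      τ = insert ρ (suc q)

    iter-insert-suc : ∀ {x} m → (∀ {t} → t < m → iter ρ t x ≢ q) → iter τ m (suc x) ≡ suc (iter ρ m x)
    iter-insert-suc zero    avoids = refl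
    iter-insert-suc (suc m) avoids =
      trans (cong (τ ⟨$⟩ʳ_) (iter-insert-suc m (avoids ∘ m<n⇒m<1+n))) (insert-suc-other (avoids ≤-refl))

    insert-suc-lifts : ∀ {x} → ¬ SameCycle ρ x q → LiftsOrbit τ ρ x
    insert-suc-lifts ¬xq m = iter-insert-suc m (λ {t} _ eq → ¬xq (t , eq))

    iter-insert-suc-zero : ∀ {c} → CycleLength ρ q c → ∀ {m} → m < c → iter τ (suc m) zero ≡ suc (iter ρ (suc m) q)
    iter-insert-suc-zero (_ , _ , first) {m} m<c = begin
      iter τ (suc m) zero          ≡⟨ iter-suc τ m zero ⟩
      iter τ m (suc (ρ ⟨$⟩ʳ q))    ≡⟨ iter-insert-suc m avoids ⟩
      suc (iter ρ m (ρ ⟨$⟩ʳ q))    ≡⟨ cong suc (iter-suc ρ m q) ⟨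
      suc (iter ρ (suc m) q)       ∎
      where
      open ≡-Reasoning
      avoids : ∀ {t} → t < m → iter ρ t (ρ ⟨$⟩ʳ q) ≢ q
      avoids {t} t<m eq = first (suc t) (s≤s z≤n) (<-≤-trans (s≤s t<m) m<c) (trans (iter-suc ρ t q) eq)

    CycleLength-insert-suc-zero : ∀ {c} → CycleLength ρ q c → CycleLength τ zero (suc c)
    CycleLength-insert-suc-zero {suc c} cl@(_ , ret , _) = s≤s z≤n , returns , first
      where
      returns : iter τ (suc (suc c)) zero ≡ zero
      returns = trans (cong (τ ⟨$⟩ʳ_) (trans (iter-insert-suc-zero cl ≤-refl) (cong suc ret))) (insert-suc-self q)
      first : ∀ m → 1 ≤ m → m < suc (suc c) → iter τ m zero ≢ zero
      first (suc m) _ (s≤s m<c) eq with () ← trans (sym (iter-insert-suc-zero cl m<c)) eq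

    private
      clq = cycleLength-CycleLength ρ q

    cycleLength-insert-suc-zero : cycleLength τ zero ≡ suc (cycleLength ρ q)
    cycleLength-insert-suc-zero = sym (CycleLength⇒≡ τ (CycleLength-insert-suc-zero clq))

    SameCycle-insert-suc-zero : ∀ {y} → SameCycle τ zero (suc y) ⇔ SameCycle ρ q y
    SameCycle-insert-suc-zero = mk⇔ to from
      where
      to : ∀ {y} → SameCycle τ zero (suc y) → SameCycle ρ q y
      to same with SameCycle-within τ same
      ... | zero  , _    , ()
      ... | suc m , m<cτ , eq = suc m , F.suc-injective (trans (sym (iter-insert-suc-zero clq m<c)) eq)
        where m<c = s≤s⁻¹ (subst (suc m <_) cycleLength-insert-suc-zero m<cτ)
      from : ∀ {y} → SameCycle ρ q y → SameCycle τ zero (suc y)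
      from same with cycleLength ρ q | clq | iter-insert-suc-zero clq | SameCycle-within ρ same
      ... | suc c | _ , ret , _ | iter-zero | zero  , _   , refl = suc c , trans (iter-zero ≤-refl) (cong suc ret)
      ... | suc c | _         | iter-zero | suc t , t<c , eq   = suc t , trans (iter-zero (<-trans (n<1+n t) t<c)) (cong suc eq)

    cycleLength-insert-suc-suc : ∀ x → cycleLength τ (suc x) ≡ 𝟙 (sameCycle? ρ x q) + cycleLength ρ x
    cycleLength-insert-suc-suc x = byCases (sameCycle? ρ x q)
      where
      byCases : (x~q? : Dec (SameCycle ρ x q)) → cycleLength τ (suc x) ≡ 𝟙 x~q? + cycleLength ρ x
      byCases (no  ¬xq) = cycleLength-lift (insert-suc-lifts ¬xq)
      byCases (yes xq)  = begin
        cycleLength τ (suc x)      ≡⟨ cycleLength-resp-SameCycle τ (Equivalence.from SameCycle-insert-suc-zero (SameCycle-sym ρ xq)) ⟩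
        cycleLength τ zero         ≡⟨ cycleLength-insert-suc-zero ⟩
        suc (cycleLength ρ q)      ≡⟨ cong suc (cycleLength-resp-SameCycle ρ xq) ⟩
        suc (cycleLength ρ x)      ∎
        where open ≡-Reasoning

  SameCycle-insert : ∀ p {x y} → SameCycle (insert ρ p) (suc x) (suc y) ⇔ SameCycle ρ x y
  SameCycle-insert zero    {x} = SameCycle-lift (insert-zero-lifts x)
  SameCycle-insert (suc q) {x} {y} with sameCycle? ρ x q
  ... | no  ¬xq = SameCycle-lift (insert-suc-lifts q ¬xq)
  ... | yes xq  = mk⇔
    (λ sx~sy → SameCycle-trans ρ xq (to (SameCycle-trans τ 0~sx sx~sy)))
    (λ x~y → SameCycle-trans τ (SameCycle-sym τ 0~sx) (from (SameCycle-trans ρ (SameCycle-sym ρ xq) x~y)))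
    where
    τ = insert ρ (suc q)
    to : ∀ {y} → SameCycle τ zero (suc y) → SameCycle ρ q y
    to = Equivalence.to (SameCycle-insert-suc-zero q)
    from : ∀ {y} → SameCycle ρ q y → SameCycle τ zero (suc y)
    from = Equivalence.from (SameCycle-insert-suc-zero q)
    0~sx : SameCycle τ zero (suc x)
    0~sx = from (SameCycle-sym ρ xq)

insert-cong : ∀ {n} {ρ ρ′ : Permutation′ n} → ρ ≈ ρ′ → ∀ p → insert ρ p ≈ insert ρ′ p
insert-cong ρ≈ρ′ p x with PC.transpose zero p x
... | zero  = refl
... | suc j = cong suc (ρ≈ρ′ j)

private
  transpose-zero-self : ∀ {n} (p : Fin (suc n)) → transpose zero p ⟨$⟩ʳ p ≡ zero
  transpose-zero-self zero    = refl
  transpose-zero-self (suc q) rewrite dec-true (q F.≟ q) refl = refl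

  lift₀-remove-zero : ∀ {n} (π : Permutation′ (suc n)) → π ⟨$⟩ʳ zero ≡ zero → lift₀ (remove zero π) ≈ π
  lift₀-remove-zero π π0≡0 zero    = sym π0≡0
  lift₀-remove-zero π π0≡0 (suc k) =
    subst (λ z → punchIn z (remove zero π ⟨$⟩ʳ k) ≡ π ⟨$⟩ʳ suc k) π0≡0 (F.punchIn-punchOut _)

insert-surjective : ∀ {n} (σ : Permutation′ (suc n)) → ∃ λ ρ → ∃ λ p → insert ρ p ≈ σ
insert-surjective σ = remove zero π , p , λ x → trans (lift₀-remove-zero π π0≡0 (t ⟨$⟩ʳ x)) (cong (σ ⟨$⟩ʳ_) (inverseˡ t))
  where
  p = σ ⟨$⟩ˡ zero
  t = transpose zero p
  π = flip t ∘ₚ σ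
  π0≡0 : π ⟨$⟩ʳ zero ≡ zero
  π0≡0 = trans (cong (σ ⟨$⟩ʳ_) (trans (cong (t ⟨$⟩ˡ_) (sym (transpose-zero-self p))) (inverseˡ t))) (inverseʳ σ)

-- Summing over all permutations

-- Sums w over the n! outcomes of successive insertions; every permutation occurs (insert-surjective).
∑𝔖 : ∀ n → (Permutation′ n → ℕ) → ℕ
∑𝔖 zero    w = w id
∑𝔖 (suc n) w = ∑𝔖 n (λ ρ → ∑[ p < suc n ] w (insert ρ p))

infixl 10 ∑𝔖
syntax ∑𝔖 n (λ σ → w) = ∑[ σ ∈𝔖 n ] w

∑𝔖-mono-≤ : ∀ n {v w : Permutation′ n → ℕ} → (∀ σ → v σ ≤ w σ) → ∑𝔖 n v ≤ ∑𝔖 n w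
∑𝔖-mono-≤ zero    v≤w = v≤w id
∑𝔖-mono-≤ (suc n) v≤w = ∑𝔖-mono-≤ n (λ ρ → ∑-mono-≤ (λ p → v≤w (insert ρ p)))

∑𝔖-cong : ∀ n {v w : Permutation′ n → ℕ} → (∀ σ → v σ ≡ w σ) → ∑𝔖 n v ≡ ∑𝔖 n w
∑𝔖-cong n v≡w = ≤-antisym (∑𝔖-mono-≤ n (≤-reflexive ∘ v≡w)) (∑𝔖-mono-≤ n (≤-reflexive ∘ sym ∘ v≡w))

∑𝔖-distrib-+ : ∀ n (v w : Permutation′ n → ℕ) → ∑[ σ ∈𝔖 n ] (v σ + w σ) ≡ ∑𝔖 n v + ∑𝔖 n w
∑𝔖-distrib-+ zero    v w = refl
∑𝔖-distrib-+ (suc n) v w = trans (∑𝔖-cong n (λ ρ → ∑-distrib-+ (v ∘ insert ρ) (w ∘ insert ρ)))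
                                 (∑𝔖-distrib-+ n _ _)

*-distribˡ-∑𝔖 : ∀ n c (w : Permutation′ n → ℕ) → c * ∑𝔖 n w ≡ ∑[ σ ∈𝔖 n ] (c * w σ)
*-distribˡ-∑𝔖 zero    c w = refl
*-distribˡ-∑𝔖 (suc n) c w = trans (*-distribˡ-∑𝔖 n c _) (∑𝔖-cong n (λ ρ → *-distribˡ-sum c (w ∘ insert ρ)))

*-distribʳ-∑𝔖 : ∀ n c (w : Permutation′ n → ℕ) → ∑𝔖 n w * c ≡ ∑[ σ ∈𝔖 n ] (w σ * c)
*-distribʳ-∑𝔖 n c w = trans (*-comm (∑𝔖 n w) c) (trans (*-distribˡ-∑𝔖 n c w) (∑𝔖-cong n (λ σ → *-comm c (w σ))))

∑𝔖-∑-comm : ∀ n m (w : Permutation′ n → Fin m → ℕ) → ∑[ σ ∈𝔖 n ] ∑[ i < m ] w σ i ≡ ∑[ i < m ] ∑[ σ ∈𝔖 n ] w σ i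
∑𝔖-∑-comm zero    m w = refl
∑𝔖-∑-comm (suc n) m w = trans (∑𝔖-cong n (λ ρ → ∑-comm (λ p i → w (insert ρ p) i))) (∑𝔖-∑-comm n m _)

∑𝔖-const : ∀ n c → ∑[ σ ∈𝔖 n ] c ≡ c * n !
∑𝔖-const zero    c = sym (*-identityʳ c)
∑𝔖-const (suc n) c = begin
  ∑[ ρ ∈𝔖 n ] ∑[ p < suc n ] c  ≡⟨ ∑𝔖-cong n (λ _ → ∑-const (suc n) c) ⟩
  ∑[ ρ ∈𝔖 n ] (suc n * c)       ≡⟨ ∑𝔖-const n (suc n * c) ⟩
  suc n * c * n !               ≡⟨ rearrange (suc n) c (n !) ⟩
  c * (suc n * n !)             ∎
  where
  open ≡-Reasoning
  rearrange : ∀ a b d → a * b * d ≡ b * (a * d)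
  rearrange = solve-∀

∑𝔖-zero : ∀ n {w : Permutation′ n → ℕ} → (∀ σ → w σ ≡ 0) → ∑𝔖 n w ≡ 0
∑𝔖-zero n w≡0 = trans (∑𝔖-cong n w≡0) (∑𝔖-const n 0)

∑𝔖-∑-weighted-≤ : ∀ n m (c : Fin m → ℕ) (X : Permutation′ n → Fin m → ℕ) {B} → (∀ i → ∑[ σ ∈𝔖 n ] X σ i ≤ B) →
  ∑[ σ ∈𝔖 n ] ∑[ i < m ] (c i * X σ i) ≤ ∑[ i < m ] c i * B
∑𝔖-∑-weighted-≤ n m c X {B} ∑X≤B = begin
  ∑[ σ ∈𝔖 n ] ∑[ i < m ] (c i * X σ i)  ≡⟨ ∑𝔖-∑-comm n m (λ σ i → c i * X σ i) ⟩
  ∑[ i < m ] ∑[ σ ∈𝔖 n ] (c i * X σ i)  ≡⟨ sum-cong-≗ {m} (λ i → *-distribˡ-∑𝔖 n (c i) (λ σ → X σ i)) ⟨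
  ∑[ i < m ] (c i * ∑[ σ ∈𝔖 n ] X σ i)  ≤⟨ ∑-mono-≤ (λ i → *-monoʳ-≤ (c i) (∑X≤B i)) ⟩
  ∑[ i < m ] (c i * B)                  ≡⟨ *-distribʳ-sum B c ⟨
  ∑[ i < m ] c i * B                    ∎
  where open ≤-Reasoning

_≈?_ : ∀ {n} (σ τ : Permutation′ n) → Dec (σ ≈ τ)
σ ≈? τ = F.all? (λ i → σ ⟨$⟩ʳ i F.≟ τ ⟨$⟩ʳ i)

1≤∑𝔖-𝟙-≈ : ∀ n (σ : Permutation′ n) → 1 ≤ ∑[ τ ∈𝔖 n ] 𝟙 (τ ≈? σ)
1≤∑𝔖-𝟙-≈ zero    σ = ≤-reflexive (sym (𝟙-yes (id ≈? σ) λ ()))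
1≤∑𝔖-𝟙-≈ (suc n) σ with insert-surjective σ
... | ρ , p , insert≈σ = ≤-trans (1≤∑𝔖-𝟙-≈ n ρ) (∑𝔖-mono-≤ n λ ρ′ →
  ≤-trans (𝟙-mono (ρ′ ≈? ρ) (insert ρ′ p ≈? σ) (λ ρ′≈ρ x → trans (insert-cong ρ′≈ρ p x) (insert≈σ x)))
          (term≤∑ (λ p′ → 𝟙 (insert ρ′ p′ ≈? σ)) p))

module _ {n : ℕ} where

  ≤∑𝔖-𝟙-≈ : (w : Permutation′ n → ℕ) → (∀ {σ τ} → σ ≈ τ → w σ ≡ w τ) →
    ∀ σ → w σ ≤ ∑[ τ ∈𝔖 n ] (𝟙 (τ ≈? σ) * w τ)
  ≤∑𝔖-𝟙-≈ w w-resp σ = begin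
    w σ                                 ≡⟨ *-identityʳ (w σ) ⟨
    w σ * 1                             ≤⟨ *-monoʳ-≤ (w σ) (1≤∑𝔖-𝟙-≈ n σ) ⟩
    w σ * ∑[ τ ∈𝔖 n ] 𝟙 (τ ≈? σ)        ≡⟨ *-distribˡ-∑𝔖 n (w σ) (λ τ → 𝟙 (τ ≈? σ)) ⟩
    ∑[ τ ∈𝔖 n ] (w σ * 𝟙 (τ ≈? σ))      ≡⟨ ∑𝔖-cong n (λ τ → byCases (τ ≈? σ)) ⟩
    ∑[ τ ∈𝔖 n ] (𝟙 (τ ≈? σ) * w τ)      ∎
    where
    open ≤-Reasoning
    byCases : ∀ {τ} (τ≈?σ : Dec (τ ≈ σ)) → w σ * 𝟙 τ≈?σ ≡ 𝟙 τ≈?σ * w τ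
    byCases (yes τ≈σ) = trans (*-identityʳ (w σ)) (trans (sym (w-resp τ≈σ)) (sym (+-identityʳ _)))
    byCases (no  _)   = *-zeroʳ (w σ)

  ∑-distinct≤∑𝔖 : (w : Permutation′ n → ℕ) → (∀ {σ τ} → σ ≈ τ → w σ ≡ w τ) →
    ∀ L → AllPairs Distinct L → sum (map w L) ≤ ∑𝔖 n w
  ∑-distinct≤∑𝔖 w w-resp []      []                  = z≤n
  ∑-distinct≤∑𝔖 w w-resp (σ ∷ L) (σ-distinct ∷ distinct) = begin
    w σ + sum (map w L)
      ≡⟨ cong (w σ +_) (agree L σ-distinct) ⟨
    w σ + sum (map w′ L)
      ≤⟨ +-mono-≤ (≤∑𝔖-𝟙-≈ w w-resp σ) (∑-distinct≤∑𝔖 w′ w′-resp L distinct) ⟩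
    ∑[ τ ∈𝔖 n ] (𝟙 (τ ≈? σ) * w τ) + ∑𝔖 n w′
      ≡⟨ ∑𝔖-distrib-+ n (λ τ → 𝟙 (τ ≈? σ) * w τ) w′ ⟨
    ∑[ τ ∈𝔖 n ] (𝟙 (τ ≈? σ) * w τ + 𝟙 (¬? (τ ≈? σ)) * w τ)
      ≡⟨ ∑𝔖-cong n (λ τ → trans (sym (*-distribʳ-+ (w τ) (𝟙 (τ ≈? σ)) _))
                                (trans (cong (_* w τ) (𝟙-+-𝟙-¬ (τ ≈? σ))) (+-identityʳ (w τ)))) ⟩
    ∑𝔖 n w
      ∎
    where
    open ≤-Reasoning
    w′ : Permutation′ n → ℕ
    w′ τ = 𝟙 (¬? (τ ≈? σ)) * w τ
    w′-resp : ∀ {τ τ′} → τ ≈ τ′ → w′ τ ≡ w′ τ′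
    w′-resp {τ} {τ′} τ≈τ′ = cong₂ _*_
      (𝟙-cong (¬? (τ ≈? σ)) (¬? (τ′ ≈? σ)) (λ τ≉σ τ′≈σ → τ≉σ (λ i → trans (τ≈τ′ i) (τ′≈σ i)))
                                         (λ τ′≉σ τ≈σ → τ′≉σ (λ i → trans (sym (τ≈τ′ i)) (τ≈σ i))))
      (w-resp τ≈τ′)
    agree : ∀ L → All (Distinct σ) L → sum (map w′ L) ≡ sum (map w L)
    agree []      []                 = refl
    agree (τ ∷ L) (σ≉τ ∷ σ-distinct) = cong₂ _+_
      (trans (cong (_* w τ) (𝟙-yes (¬? (τ ≈? σ)) (λ τ≈σ → σ≉τ (λ i → sym (τ≈σ i))))) (+-identityʳ (w τ)))
      (agree L σ-distinct)

  length*≤∑𝔖 : (w : Permutation′ n → ℕ) → (∀ {σ τ} → σ ≈ τ → w σ ≡ w τ) →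
    ∀ {t} L → AllPairs Distinct L → All (λ σ → t ≤ w σ) L → length L * t ≤ ∑𝔖 n w
  length*≤∑𝔖 w w-resp {t} L distinct t≤w = ≤-trans (bound L t≤w) (∑-distinct≤∑𝔖 w w-resp L distinct)
    where
    bound : ∀ L → All (λ σ → t ≤ w σ) L → length L * t ≤ sum (map w L)
    bound []      []           = z≤n
    bound (σ ∷ L) (t≤wσ ∷ t≤w) = +-mono-≤ t≤wσ (bound L t≤w)

-- Points and pairs on cycles of given lengths

module _ {n} (σ : Permutation′ n) where

  pointsOnCycles : ℕ → ℕ
  pointsOnCycles k = ∑[ i < n ] 𝟙 (k ≟ cycleLength σ i)

  onDistinctCycles : ℕ → ℕ → Fin n → Fin n → ℕ
  onDistinctCycles k₁ k₂ i j = 𝟙 (k₁ ≟ cycleLength σ i) * 𝟙 (k₂ ≟ cycleLength σ j) * 𝟙 (differentCycles? σ i j)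

  pairsOnCycles : ℕ → ℕ → ℕ
  pairsOnCycles k₁ k₂ = ∑[ i < n ] ∑[ j < n ] onDistinctCycles k₁ k₂ i j

  onDistinctCycles-sym : ∀ k₁ k₂ i j → onDistinctCycles k₁ k₂ i j ≡ onDistinctCycles k₂ k₁ j i
  onDistinctCycles-sym k₁ k₂ i j = begin
    𝟙 (k₁ ≟ cycleLength σ i) * 𝟙 (k₂ ≟ cycleLength σ j) * 𝟙 (differentCycles? σ i j)
      ≡⟨ cong₂ _*_ (*-comm (𝟙 (k₁ ≟ cycleLength σ i)) _)
                   (𝟙-cong (differentCycles? σ i j) (differentCycles? σ j i) (DifferentCycles-sym σ) (DifferentCycles-sym σ)) ⟩
    𝟙 (k₂ ≟ cycleLength σ j) * 𝟙 (k₁ ≟ cycleLength σ i) * 𝟙 (differentCycles? σ j i) ∎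
    where open ≡-Reasoning

  pairsOnCycles-sym : ∀ k₁ k₂ → pairsOnCycles k₁ k₂ ≡ pairsOnCycles k₂ k₁
  pairsOnCycles-sym k₁ k₂ = trans (sum-cong-≗ λ i → sum-cong-≗ λ j → onDistinctCycles-sym k₁ k₂ i j)
                                 (∑-comm (λ i j → onDistinctCycles k₂ k₁ j i))

  onDistinctCycles≡0 : ∀ k₁ k₂ i j → ¬ (k₁ ≡ cycleLength σ i × k₂ ≡ cycleLength σ j × DifferentCycles σ i j) →
    onDistinctCycles k₁ k₂ i j ≡ 0
  onDistinctCycles≡0 k₁ k₂ i j ¬all = byCases (k₁ ≟ cycleLength σ i) (k₂ ≟ cycleLength σ j) (differentCycles? σ i j)
    where
    byCases : (d₁ : Dec (k₁ ≡ cycleLength σ i)) (d₂ : Dec (k₂ ≡ cycleLength σ j)) (d₃ : Dec (DifferentCycles σ i j)) →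
      𝟙 d₁ * 𝟙 d₂ * 𝟙 d₃ ≡ 0
    byCases (yes e₁) (yes e₂) (yes diff) = contradiction (e₁ , e₂ , diff) ¬all
    byCases (yes _)  (yes _)  (no _)     = refl
    byCases (yes _)  (no _)   d₃         = refl
    byCases (no _)   d₂       d₃         = refl

  pointsOnCycles-zero : pointsOnCycles 0 ≡ 0
  pointsOnCycles-zero = ∑-zero {f = λ i → 𝟙 (0 ≟ cycleLength σ i)} λ i →
    𝟙-no (0 ≟ cycleLength σ i) (<⇒≢ (proj₁ (cycleLength-CycleLength σ i)))

  pointsOnCycles-vanish : ∀ {k} → n < k → pointsOnCycles k ≡ 0
  pointsOnCycles-vanish {k} n<k = ∑-zero {f = λ i → 𝟙 (k ≟ cycleLength σ i)} λ i →
    𝟙-no (k ≟ cycleLength σ i) λ { refl → <⇒≱ n<k (cycleLength≤n σ i) }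

  pairsOnCycles-zeroˡ : ∀ k → pairsOnCycles 0 k ≡ 0
  pairsOnCycles-zeroˡ k = ∑-zero {f = λ i → ∑[ j < n ] onDistinctCycles 0 k i j} λ i →
    ∑-zero {f = onDistinctCycles 0 k i} λ j → onDistinctCycles≡0 0 k i j λ (0≡ℓ , _) →
    <⇒≢ (proj₁ (cycleLength-CycleLength σ i)) 0≡ℓ

  pairsOnCycles-vanish : ∀ {k₁ k₂} → n < k₁ + k₂ → pairsOnCycles k₁ k₂ ≡ 0
  pairsOnCycles-vanish {k₁} {k₂} n<k₁+k₂ = ∑-zero {f = λ i → ∑[ j < n ] onDistinctCycles k₁ k₂ i j} λ i →
    ∑-zero {f = onDistinctCycles k₁ k₂ i} λ j → onDistinctCycles≡0 k₁ k₂ i j λ { (refl , refl , diff) →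
    <⇒≱ n<k₁+k₂ (cycleLength-+-≤n σ diff) }

  *≤pairsOnCycles : ∀ {i j k₁ k₂} → CycleLength σ i k₁ → CycleLength σ j k₂ → DifferentCycles σ i j →
    k₁ * k₂ ≤ pairsOnCycles k₁ k₂
  *≤pairsOnCycles {i} {j} {k₁} {k₂} clᵢ clⱼ diff = begin
    k₁ * k₂
      ≡⟨ cong₂ _*_ (trans (CycleLength⇒≡ σ clᵢ) (sym (∑-𝟙-sameCycle σ i))) (trans (CycleLength⇒≡ σ clⱼ) (sym (∑-𝟙-sameCycle σ j))) ⟩
    ∑[ x < n ] 𝟙 (sameCycle? σ i x) * ∑[ y < n ] 𝟙 (sameCycle? σ j y)
      ≡⟨ *-distribʳ-sum (∑[ y < n ] 𝟙 (sameCycle? σ j y)) (𝟙 ∘ sameCycle? σ i) ⟩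
    ∑[ x < n ] (𝟙 (sameCycle? σ i x) * ∑[ y < n ] 𝟙 (sameCycle? σ j y))
      ≡⟨ sum-cong-≗ (λ x → *-distribˡ-sum (𝟙 (sameCycle? σ i x)) (𝟙 ∘ sameCycle? σ j)) ⟩
    ∑[ x < n ] ∑[ y < n ] (𝟙 (sameCycle? σ i x) * 𝟙 (sameCycle? σ j y))
      ≤⟨ ∑-mono-≤ (λ x → ∑-mono-≤ (λ y → byCases (sameCycle? σ i x) (sameCycle? σ j y))) ⟩
    pairsOnCycles k₁ k₂
      ∎
    where
    open ≤-Reasoning
    byCases : ∀ {x y} (i~x? : Dec (SameCycle σ i x)) (j~y? : Dec (SameCycle σ j y)) → 𝟙 i~x? * 𝟙 j~y? ≤ onDistinctCycles k₁ k₂ x y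
    byCases {x} {y} (yes i~x) (yes j~y) = ≤-reflexive (sym (trans
      (cong₂ _*_ (cong₂ _*_ (𝟙-yes (k₁ ≟ _) (trans (CycleLength⇒≡ σ clᵢ) (sym (cycleLength-resp-SameCycle σ i~x))))
                            (𝟙-yes (k₂ ≟ _) (trans (CycleLength⇒≡ σ clⱼ) (sym (cycleLength-resp-SameCycle σ j~y)))))
                 (𝟙-yes (differentCycles? σ x y) λ m eq → uncurry diff (SameCycle-trans σ (SameCycle-trans σ i~x (m , eq)) (SameCycle-sym σ j~y))))
      refl))
    byCases (yes _) (no _) = z≤n
    byCases (no _)  _      = z≤n

pairsOnCycles-resp-≈ : ∀ {n} {σ τ : Permutation′ n} → σ ≈ τ → ∀ k₁ k₂ → pairsOnCycles σ k₁ k₂ ≡ pairsOnCycles τ k₁ k₂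
pairsOnCycles-resp-≈ {σ = σ} {τ} σ≈τ k₁ k₂ = sum-cong-≗ λ i → sum-cong-≗ λ j →
  cong₂ _*_ (cong₂ _*_ (cong (𝟙 ∘ (k₁ ≟_)) (cycleLength-resp-≈ σ≈τ i)) (cong (𝟙 ∘ (k₂ ≟_)) (cycleLength-resp-≈ σ≈τ j)))
            (𝟙-cong (differentCycles? σ i j) (differentCycles? τ i j)
                    (DifferentCycles-resp-≈ σ≈τ) (DifferentCycles-resp-≈ (λ x → sym (σ≈τ x))))

module _ {n} (ρ : Permutation′ n) where

  private
    ℓ = cycleLength ρ

  ∑-𝟙-cycleLength-insert-new : ∀ a →
    ∑[ p < suc n ] 𝟙 (suc a ≟ cycleLength (insert ρ p) zero) ≡ 𝟙 (a ≟ 0) + pointsOnCycles ρ a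
  ∑-𝟙-cycleLength-insert-new a = cong₂ _+_
    (cong (𝟙 ∘ (suc a ≟_)) (cycleLength-insert-zero-zero ρ))
    (sum-cong-≗ λ q → cong (𝟙 ∘ (suc a ≟_)) (cycleLength-insert-suc-zero ρ q))

  ∑-𝟙-cycleLength-insert-old : ∀ a x →
    ∑[ p < suc n ] 𝟙 (suc a ≟ cycleLength (insert ρ p) (suc x)) ≡ 𝟙 (a ≟ ℓ x) * a + 𝟙 (suc a ≟ ℓ x) * (n ∸ a)
  ∑-𝟙-cycleLength-insert-old a x = begin
    ∑[ p < suc n ] 𝟙 (suc a ≟ cycleLength (insert ρ p) (suc x))
      ≡⟨ cong₂ _+_ (cong (𝟙 ∘ (suc a ≟_)) (cycleLength-lift (insert-zero-lifts ρ x)))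
                   (sum-cong-≗ λ q → cong (𝟙 ∘ (suc a ≟_)) (cycleLength-insert-suc-suc ρ q x)) ⟩
    𝟙 (suc a ≟ ℓ x) + ∑[ q < n ] 𝟙 (suc a ≟ 𝟙 (sameCycle? ρ x q) + ℓ x)
      ≡⟨ cong (𝟙 (suc a ≟ ℓ x) +_) (∑-𝟙-split (sameCycle? ρ x) (λ b → 𝟙 (suc a ≟ b + ℓ x))) ⟩
    𝟙 (suc a ≟ ℓ x) + (𝟙 (a ≟ ℓ x) * ∑[ q < n ] 𝟙 (sameCycle? ρ x q) + 𝟙 (suc a ≟ ℓ x) * N)
      ≡⟨ cong (λ c → 𝟙 (suc a ≟ ℓ x) + (𝟙 (a ≟ ℓ x) * c + 𝟙 (suc a ≟ ℓ x) * N)) (∑-𝟙-sameCycle ρ x) ⟩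
    𝟙 (suc a ≟ ℓ x) + (𝟙 (a ≟ ℓ x) * ℓ x + 𝟙 (suc a ≟ ℓ x) * N)
      ≡⟨ byCases (a ≟ ℓ x) (suc a ≟ ℓ x) ⟩
    𝟙 (a ≟ ℓ x) * a + 𝟙 (suc a ≟ ℓ x) * (n ∸ a)
      ∎
    where
    open ≡-Reasoning
    N = ∑[ q < n ] 𝟙 (¬? (sameCycle? ρ x q))
    ℓ+N≡n : ℓ x + N ≡ n
    ℓ+N≡n = trans (cong (_+ N) (sym (∑-𝟙-sameCycle ρ x))) (∑-𝟙-+-∑-𝟙-¬ (sameCycle? ρ x))
    byCases : (d₀ : Dec (a ≡ ℓ x)) (d₁ : Dec (suc a ≡ ℓ x)) →
      𝟙 d₁ + (𝟙 d₀ * ℓ x + 𝟙 d₁ * N) ≡ 𝟙 d₀ * a + 𝟙 d₁ * (n ∸ a)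
    byCases (yes a≡ℓ) (yes sa≡ℓ) = contradiction (trans a≡ℓ (sym sa≡ℓ)) (<⇒≢ (n<1+n a))
    byCases (yes a≡ℓ) (no _)     = cong (λ c → (c + 0) + 0) (sym a≡ℓ)
    byCases (no _)    (yes sa≡ℓ) = trans (cong suc (+-identityʳ N)) (sym (trans (+-identityʳ (n ∸ a)) (begin
      n ∸ a              ≡⟨ cong (_∸ a) (trans (sym ℓ+N≡n) (cong (_+ N) (sym sa≡ℓ))) ⟩
      suc a + N ∸ a      ≡⟨ cong (_∸ a) (+-suc a N) ⟨
      a + suc N ∸ a      ≡⟨ m+n∸m≡n a (suc N) ⟩
      suc N              ∎)))
    byCases (no _)    (no _)     = refl

  -- The new point lies on a (1 + a)-cycle iff it is fixed (a = 0) or joins an a-cycle; an old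
  -- point on an m-cycle moves to an (m + 1)-cycle for exactly the m positions on its cycle.
  ∑-pointsOnCycles-insert : ∀ a → ∑[ p < suc n ] pointsOnCycles (insert ρ p) (suc a) ≡
    𝟙 (a ≟ 0) + pointsOnCycles ρ a * suc a + pointsOnCycles ρ (suc a) * (n ∸ a)
  ∑-pointsOnCycles-insert a = begin
    ∑[ p < suc n ] (𝟙 (suc a ≟ cycleLength (insert ρ p) zero) + ∑[ x < n ] 𝟙 (suc a ≟ cycleLength (insert ρ p) (suc x)))
      ≡⟨ ∑-distrib-+ (λ p → 𝟙 (suc a ≟ cycleLength (insert ρ p) zero)) (λ p → ∑[ x < n ] 𝟙 (suc a ≟ cycleLength (insert ρ p) (suc x))) ⟩
    ∑[ p < suc n ] 𝟙 (suc a ≟ cycleLength (insert ρ p) zero) + ∑[ p < suc n ] ∑[ x < n ] 𝟙 (suc a ≟ cycleLength (insert ρ p) (suc x))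
      ≡⟨ cong₂ _+_ (∑-𝟙-cycleLength-insert-new a) (∑-comm (λ p x → 𝟙 (suc a ≟ cycleLength (insert ρ p) (suc x)))) ⟩
    𝟙 (a ≟ 0) + A a + ∑[ x < n ] ∑[ p < suc n ] 𝟙 (suc a ≟ cycleLength (insert ρ p) (suc x))
      ≡⟨ cong (𝟙 (a ≟ 0) + A a +_) (sum-cong-≗ (∑-𝟙-cycleLength-insert-old a)) ⟩
    𝟙 (a ≟ 0) + A a + ∑[ x < n ] (𝟙 (a ≟ ℓ x) * a + 𝟙 (suc a ≟ ℓ x) * (n ∸ a))
      ≡⟨ cong (𝟙 (a ≟ 0) + A a +_) (trans (∑-distrib-+ (λ x → 𝟙 (a ≟ ℓ x) * a) (λ x → 𝟙 (suc a ≟ ℓ x) * (n ∸ a)))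
           (sym (cong₂ _+_ (*-distribʳ-sum a (λ x → 𝟙 (a ≟ ℓ x))) (*-distribʳ-sum (n ∸ a) (λ x → 𝟙 (suc a ≟ ℓ x)))))) ⟩
    𝟙 (a ≟ 0) + A a + (A a * a + A (suc a) * (n ∸ a))
      ≡⟨ rearrange (𝟙 (a ≟ 0)) (A a) a (A (suc a) * (n ∸ a)) ⟩
    𝟙 (a ≟ 0) + A a * suc a + A (suc a) * (n ∸ a)
      ∎
    where
    open ≡-Reasoning
    A = pointsOnCycles ρ
    rearrange : ∀ i x a y → i + x + (x * a + y) ≡ i + x * suc a + y
    rearrange = solve-∀

  onDistinctCycles-insert-fixed : ∀ a k y →
    onDistinctCycles (insert ρ zero) (suc a) k zero (suc y) ≡ 𝟙 (a ≟ 0) * 𝟙 (k ≟ ℓ y)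
  onDistinctCycles-insert-fixed a k y = begin
    onDistinctCycles (insert ρ zero) (suc a) k zero (suc y)
      ≡⟨ cong₂ _*_ (cong₂ _*_ (cong (𝟙 ∘ (suc a ≟_)) (cycleLength-insert-zero-zero ρ))
                              (cong (𝟙 ∘ (k ≟_)) (cycleLength-lift (insert-zero-lifts ρ y))))
                   (𝟙-yes (differentCycles? (insert ρ zero) zero (suc y)) λ m eq → ¬SameCycle-insert-zero ρ (m , eq)) ⟩
    𝟙 (a ≟ 0) * 𝟙 (k ≟ ℓ y) * 1
      ≡⟨ *-identityʳ _ ⟩
    𝟙 (a ≟ 0) * 𝟙 (k ≟ ℓ y)
      ∎
    where open ≡-Reasoning

  onDistinctCycles-insert-after : ∀ a k q y →
    onDistinctCycles (insert ρ (suc q)) (suc a) k zero (suc y) ≡ onDistinctCycles ρ a k q y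
  onDistinctCycles-insert-after a k q y = begin
    onDistinctCycles (insert ρ (suc q)) (suc a) k zero (suc y)
      ≡⟨ cong₂ _*_ (cong₂ _*_ (cong (𝟙 ∘ (suc a ≟_)) (cycleLength-insert-suc-zero ρ q))
                              (cong (𝟙 ∘ (k ≟_)) (cycleLength-insert-suc-suc ρ q y)))
                   (𝟙-cong (differentCycles? (insert ρ (suc q)) zero (suc y)) (differentCycles? ρ q y)
                     (λ diff m eq → uncurry diff (Equivalence.from (SameCycle-insert-suc-zero ρ q) (m , eq)))
                     (λ diff m eq → uncurry diff (Equivalence.to (SameCycle-insert-suc-zero ρ q) (m , eq)))) ⟩
    𝟙 (a ≟ ℓ q) * 𝟙 (k ≟ 𝟙 (sameCycle? ρ y q) + ℓ y) * 𝟙 (differentCycles? ρ q y)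
      ≡⟨ byCases (differentCycles? ρ q y) ⟩
    onDistinctCycles ρ a k q y
      ∎
    where
    open ≡-Reasoning
    byCases : (d : Dec (DifferentCycles ρ q y)) →
      𝟙 (a ≟ ℓ q) * 𝟙 (k ≟ 𝟙 (sameCycle? ρ y q) + ℓ y) * 𝟙 d ≡ 𝟙 (a ≟ ℓ q) * 𝟙 (k ≟ ℓ y) * 𝟙 d
    byCases (yes diff) = cong (λ c → 𝟙 (a ≟ ℓ q) * 𝟙 (k ≟ c + ℓ y) * 1)
      (𝟙-no (sameCycle? ρ y q) λ y~q → uncurry diff (SameCycle-sym ρ y~q))
    byCases (no _)     = trans (*-zeroʳ (𝟙 (a ≟ ℓ q) * 𝟙 (k ≟ 𝟙 (sameCycle? ρ y q) + ℓ y))) (sym (*-zeroʳ (𝟙 (a ≟ ℓ q) * 𝟙 (k ≟ ℓ y))))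

  ∑-onDistinctCycles-insert-new : ∀ a k →
    ∑[ p < suc n ] ∑[ y < n ] onDistinctCycles (insert ρ p) (suc a) k zero (suc y) ≡ 𝟙 (a ≟ 0) * pointsOnCycles ρ k + pairsOnCycles ρ a k
  ∑-onDistinctCycles-insert-new a k = cong₂ _+_
    (trans (sum-cong-≗ (onDistinctCycles-insert-fixed a k)) (sym (*-distribˡ-sum (𝟙 (a ≟ 0)) (λ y → 𝟙 (k ≟ ℓ y)))))
    (sum-cong-≗ λ q → sum-cong-≗ (onDistinctCycles-insert-after a k q))

  ∑-onDistinctCycles-insert-new′ : ∀ k b →
    ∑[ p < suc n ] ∑[ x < n ] onDistinctCycles (insert ρ p) k (suc b) (suc x) zero ≡ 𝟙 (b ≟ 0) * pointsOnCycles ρ k + pairsOnCycles ρ k b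
  ∑-onDistinctCycles-insert-new′ k b = begin
    ∑[ p < suc n ] ∑[ x < n ] onDistinctCycles (insert ρ p) k (suc b) (suc x) zero
      ≡⟨ sum-cong-≗ (λ p → sum-cong-≗ λ x → onDistinctCycles-sym (insert ρ p) k (suc b) (suc x) zero) ⟩
    ∑[ p < suc n ] ∑[ x < n ] onDistinctCycles (insert ρ p) (suc b) k zero (suc x)
      ≡⟨ ∑-onDistinctCycles-insert-new b k ⟩
    𝟙 (b ≟ 0) * pointsOnCycles ρ k + pairsOnCycles ρ b k
      ≡⟨ cong (𝟙 (b ≟ 0) * pointsOnCycles ρ k +_) (pairsOnCycles-sym ρ b k) ⟩
    𝟙 (b ≟ 0) * pointsOnCycles ρ k + pairsOnCycles ρ k b
      ∎
    where open ≡-Reasoning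

  private
    twoOldPoints-arith : ∀ {a b c₁ c₂ N} → c₁ + c₂ + N ≡ n →
      (d₁ : Dec (a ≡ c₁)) (d₂ : Dec (suc a ≡ c₁)) (e₁ : Dec (b ≡ c₂)) (e₂ : Dec (suc b ≡ c₂)) →
      𝟙 d₂ * 𝟙 e₂ + (𝟙 d₁ * 𝟙 e₂ * c₁ + 𝟙 d₂ * 𝟙 e₁ * c₂ + 𝟙 d₂ * 𝟙 e₂ * N)
        ≡ 𝟙 d₁ * 𝟙 e₂ * a + 𝟙 d₂ * 𝟙 e₁ * b + 𝟙 d₂ * 𝟙 e₂ * (n ∸ (a + suc b))
    twoOldPoints-arith _ (yes refl) (yes sa≡a) _ _ = contradiction (sym sa≡a) (<⇒≢ (n<1+n _))
    twoOldPoints-arith _ _ _ (yes refl) (yes sb≡b) = contradiction (sym sb≡b) (<⇒≢ (n<1+n _))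
    twoOldPoints-arith _ (yes refl) (no _) (yes refl) (no _) = refl
    twoOldPoints-arith _ (yes refl) (no _) (no _) (yes refl) = refl
    twoOldPoints-arith _ (yes refl) (no _) (no _) (no _)     = refl
    twoOldPoints-arith _ (no _) (yes refl) (yes refl) (no _) = refl
    twoOldPoints-arith {a} {b} {N = N} total (no _) (yes refl) (no _) (yes refl) = begin
      suc (0 + 0 + (N + 0))    ≡⟨ cong suc (+-identityʳ N) ⟩
      suc N                    ≡⟨ m+n∸m≡n (a + suc b) (suc N) ⟨
      a + suc b + suc N ∸ (a + suc b)  ≡⟨ cong (_∸ (a + suc b)) (trans (rearrange a b N) total) ⟩
      n ∸ (a + suc b)          ≡⟨ +-identityʳ _ ⟨
      0 + 0 + (n ∸ (a + suc b) + 0) ∎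
      where
      open ≡-Reasoning
      rearrange : ∀ a b N → a + suc b + suc N ≡ suc a + suc b + N
      rearrange = solve-∀
    twoOldPoints-arith _ (no _) (yes refl) (no _) (no _)     = refl
    twoOldPoints-arith _ (no _) (no _) _ _                   = refl

  ∑-𝟙-cycleLengths-insert-old : ∀ a b {x y} → DifferentCycles ρ x y →
    ∑[ p < suc n ] (𝟙 (suc a ≟ cycleLength (insert ρ p) (suc x)) * 𝟙 (suc b ≟ cycleLength (insert ρ p) (suc y)))
      ≡ 𝟙 (a ≟ ℓ x) * 𝟙 (suc b ≟ ℓ y) * a + 𝟙 (suc a ≟ ℓ x) * 𝟙 (b ≟ ℓ y) * b
        + 𝟙 (suc a ≟ ℓ x) * 𝟙 (suc b ≟ ℓ y) * (n ∸ (a + suc b))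
  ∑-𝟙-cycleLengths-insert-old a b {x} {y} diff = begin
    ∑[ p < suc n ] (𝟙 (suc a ≟ cycleLength (insert ρ p) (suc x)) * 𝟙 (suc b ≟ cycleLength (insert ρ p) (suc y)))
      ≡⟨ cong₂ _+_ (cong₂ _*_ (cong (𝟙 ∘ (suc a ≟_)) (cycleLength-lift (insert-zero-lifts ρ x)))
                              (cong (𝟙 ∘ (suc b ≟_)) (cycleLength-lift (insert-zero-lifts ρ y))))
                   (sum-cong-≗ λ q → cong₂ _*_ (cong (𝟙 ∘ (suc a ≟_)) (cycleLength-insert-suc-suc ρ q x))
                                               (cong (𝟙 ∘ (suc b ≟_)) (cycleLength-insert-suc-suc ρ q y))) ⟩
    F 0 0 + ∑[ q < n ] F (𝟙 (sameCycle? ρ x q)) (𝟙 (sameCycle? ρ y q))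
      ≡⟨ cong (F 0 0 +_) (∑-𝟙-split₂ (sameCycle? ρ x) (sameCycle? ρ y) disjoint F) ⟩
    F 0 0 + (F 1 0 * ∑[ q < n ] 𝟙 (sameCycle? ρ x q) + F 0 1 * ∑[ q < n ] 𝟙 (sameCycle? ρ y q) + F 0 0 * N)
      ≡⟨ cong₂ (λ c₁ c₂ → F 0 0 + (F 1 0 * c₁ + F 0 1 * c₂ + F 0 0 * N)) (∑-𝟙-sameCycle ρ x) (∑-𝟙-sameCycle ρ y) ⟩
    F 0 0 + (F 1 0 * ℓ x + F 0 1 * ℓ y + F 0 0 * N)
      ≡⟨ twoOldPoints-arith total (a ≟ ℓ x) (suc a ≟ ℓ x) (b ≟ ℓ y) (suc b ≟ ℓ y) ⟩
    𝟙 (a ≟ ℓ x) * 𝟙 (suc b ≟ ℓ y) * a + 𝟙 (suc a ≟ ℓ x) * 𝟙 (b ≟ ℓ y) * b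
      + 𝟙 (suc a ≟ ℓ x) * 𝟙 (suc b ≟ ℓ y) * (n ∸ (a + suc b))
      ∎
    where
    open ≡-Reasoning
    F : ℕ → ℕ → ℕ
    F u v = 𝟙 (suc a ≟ u + ℓ x) * 𝟙 (suc b ≟ v + ℓ y)
    disjoint : ∀ q → SameCycle ρ x q → ¬ SameCycle ρ y q
    disjoint q x~q y~q = uncurry diff (SameCycle-trans ρ x~q (SameCycle-sym ρ y~q))
    N = ∑[ q < n ] 𝟙 (¬? (sameCycle? ρ x q) ×-dec ¬? (sameCycle? ρ y q))
    total : ℓ x + ℓ y + N ≡ n
    total = begin
      ℓ x + ℓ y + N
        ≡⟨ cong₂ (λ c₁ c₂ → c₁ + c₂ + N) (sym (∑-𝟙-sameCycle ρ x)) (sym (∑-𝟙-sameCycle ρ y)) ⟩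
      ∑[ q < n ] 𝟙 (sameCycle? ρ x q) + ∑[ q < n ] 𝟙 (sameCycle? ρ y q) + N
        ≡⟨ sym (trans (∑-𝟙-split₂ (sameCycle? ρ x) (sameCycle? ρ y) disjoint (λ _ _ → 1))
                      (cong₂ _+_ (cong₂ _+_ (*-identityˡ (∑[ q < n ] 𝟙 (sameCycle? ρ x q))) (*-identityˡ (∑[ q < n ] 𝟙 (sameCycle? ρ y q))))
                                 (*-identityˡ N))) ⟩
      ∑[ q < n ] 1
        ≡⟨ trans (∑-const n 1) (*-identityʳ n) ⟩
      n ∎

  ∑-onDistinctCycles-insert-old : ∀ a b x y →
    ∑[ p < suc n ] onDistinctCycles (insert ρ p) (suc a) (suc b) (suc x) (suc y) ≡
      onDistinctCycles ρ a (suc b) x y * a + onDistinctCycles ρ (suc a) b x y * b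
      + onDistinctCycles ρ (suc a) (suc b) x y * (n ∸ (a + suc b))
  ∑-onDistinctCycles-insert-old a b x y = begin
    ∑[ p < suc n ] onDistinctCycles (insert ρ p) (suc a) (suc b) (suc x) (suc y)
      ≡⟨ sum-cong-≗ (λ p → cong (L p *_) (𝟙-cong (differentCycles? (insert ρ p) (suc x) (suc y)) (differentCycles? ρ x y)
           (λ diff m eq → uncurry diff (Equivalence.from (SameCycle-insert ρ p) (m , eq)))
           (λ diff m eq → uncurry diff (Equivalence.to (SameCycle-insert ρ p) (m , eq))))) ⟩
    ∑[ p < suc n ] (L p * 𝟙 (differentCycles? ρ x y))
      ≡⟨ *-distribʳ-sum (𝟙 (differentCycles? ρ x y)) L ⟨
    ∑[ p < suc n ] L p * 𝟙 (differentCycles? ρ x y)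
      ≡⟨ byCases (differentCycles? ρ x y) ⟩
    (X₁ * a + X₂ * b + X₃ * (n ∸ (a + suc b))) * 𝟙 (differentCycles? ρ x y)
      ≡⟨ rearrange (𝟙 (a ≟ ℓ x)) (𝟙 (suc b ≟ ℓ y)) (𝟙 (suc a ≟ ℓ x)) (𝟙 (b ≟ ℓ y))
                   (𝟙 (differentCycles? ρ x y)) a b (n ∸ (a + suc b)) ⟩
    onDistinctCycles ρ a (suc b) x y * a + onDistinctCycles ρ (suc a) b x y * b
      + onDistinctCycles ρ (suc a) (suc b) x y * (n ∸ (a + suc b))
      ∎
    where
    open ≡-Reasoning
    L : Fin (suc n) → ℕ
    L p = 𝟙 (suc a ≟ cycleLength (insert ρ p) (suc x)) * 𝟙 (suc b ≟ cycleLength (insert ρ p) (suc y))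
    X₁ = 𝟙 (a ≟ ℓ x) * 𝟙 (suc b ≟ ℓ y)
    X₂ = 𝟙 (suc a ≟ ℓ x) * 𝟙 (b ≟ ℓ y)
    X₃ = 𝟙 (suc a ≟ ℓ x) * 𝟙 (suc b ≟ ℓ y)
    byCases : (d : Dec (DifferentCycles ρ x y)) →
      ∑[ p < suc n ] L p * 𝟙 d ≡ (X₁ * a + X₂ * b + X₃ * (n ∸ (a + suc b))) * 𝟙 d
    byCases (yes diff) = cong (_* 1) (∑-𝟙-cycleLengths-insert-old a b diff)
    byCases (no _)     = trans (*-zeroʳ (∑[ p < suc n ] L p)) (sym (*-zeroʳ (X₁ * a + X₂ * b + X₃ * (n ∸ (a + suc b)))))
    rearrange : ∀ u₁ v₁ u₂ v₂ δ a b c → (u₁ * v₁ * a + u₂ * v₂ * b + u₂ * v₁ * c) * δ ≡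
      u₁ * v₁ * δ * a + u₂ * v₂ * δ * b + u₂ * v₁ * δ * c
    rearrange = solve-∀

  ∑-∑-onDistinctCycles-insert-old : ∀ a b →
    ∑[ p < suc n ] ∑[ x < n ] ∑[ y < n ] onDistinctCycles (insert ρ p) (suc a) (suc b) (suc x) (suc y) ≡
      pairsOnCycles ρ a (suc b) * a + pairsOnCycles ρ (suc a) b * b + pairsOnCycles ρ (suc a) (suc b) * (n ∸ (a + suc b))
  ∑-∑-onDistinctCycles-insert-old a b = begin
    ∑[ p < suc n ] ∑[ x < n ] ∑[ y < n ] D p x y          ≡⟨ ∑-comm (λ p x → ∑[ y < n ] D p x y) ⟩
    ∑[ x < n ] ∑[ p < suc n ] ∑[ y < n ] D p x y          ≡⟨ sum-cong-≗ (λ x → ∑-comm (λ p y → D p x y)) ⟩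
    ∑[ x < n ] ∑[ y < n ] ∑[ p < suc n ] D p x y          ≡⟨ sum-cong-≗ (λ x → sum-cong-≗ (∑-onDistinctCycles-insert-old a b x)) ⟩
    ∑[ x < n ] ∑[ y < n ] (O₁ x y * a + O₂ x y * b + O₃ x y * (n ∸ (a + suc b)))
                                                          ≡⟨ ∑₂-linear₃ O₁ O₂ O₃ a b (n ∸ (a + suc b)) ⟩
    pairsOnCycles ρ a (suc b) * a + pairsOnCycles ρ (suc a) b * b + pairsOnCycles ρ (suc a) (suc b) * (n ∸ (a + suc b))
                                                          ∎
    where
    open ≡-Reasoning
    D : Fin (suc n) → Fin n → Fin n → ℕ
    D p x y = onDistinctCycles (insert ρ p) (suc a) (suc b) (suc x) (suc y)
    O₁ = onDistinctCycles ρ a (suc b)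
    O₂ = onDistinctCycles ρ (suc a) b
    O₃ = onDistinctCycles ρ (suc a) (suc b)

  ∑-pairsOnCycles-insert : ∀ a b → ∑[ p < suc n ] pairsOnCycles (insert ρ p) (suc a) (suc b) ≡
    (𝟙 (a ≟ 0) * pointsOnCycles ρ (suc b) + pairsOnCycles ρ a (suc b) * suc a)
    + (𝟙 (b ≟ 0) * pointsOnCycles ρ (suc a) + pairsOnCycles ρ (suc a) b * suc b)
    + pairsOnCycles ρ (suc a) (suc b) * (n ∸ (a + suc b))
  ∑-pairsOnCycles-insert a b = begin
    ∑[ p < suc n ] ((D p zero zero + ∑[ y < n ] D p zero (suc y)) + ∑[ x < n ] (D p (suc x) zero + ∑[ y < n ] D p (suc x) (suc y)))
      ≡⟨ trans (∑-distrib-+ (λ p → D p zero zero + ∑[ y < n ] D p zero (suc y)) (λ p → ∑[ x < n ] (D p (suc x) zero + ∑[ y < n ] D p (suc x) (suc y))))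
               (cong₂ _+_ (∑-distrib-+ (λ p → D p zero zero) (λ p → ∑[ y < n ] D p zero (suc y)))
                          (trans (sum-cong-≗ λ p → ∑-distrib-+ (λ x → D p (suc x) zero) (λ x → ∑[ y < n ] D p (suc x) (suc y)))
                                 (∑-distrib-+ (λ p → ∑[ x < n ] D p (suc x) zero) (λ p → ∑[ x < n ] ∑[ y < n ] D p (suc x) (suc y))))) ⟩
    ∑[ p < suc n ] D p zero zero + ∑[ p < suc n ] ∑[ y < n ] D p zero (suc y)
      + (∑[ p < suc n ] ∑[ x < n ] D p (suc x) zero + ∑[ p < suc n ] ∑[ x < n ] ∑[ y < n ] D p (suc x) (suc y))
      ≡⟨ cong₂ _+_ (cong₂ _+_ (∑-zero {suc n} λ p → onDistinctCycles≡0 (insert ρ p) (suc a) (suc b) zero zero λ (_ , _ , diff) → diff 0 refl)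
                              (∑-onDistinctCycles-insert-new a (suc b)))
                   (cong₂ _+_ (∑-onDistinctCycles-insert-new′ (suc a) b) (∑-∑-onDistinctCycles-insert-old a b)) ⟩
    0 + (𝟙 (a ≟ 0) * A (suc b) + T a (suc b)) + ((𝟙 (b ≟ 0) * A (suc a) + T (suc a) b) + (T a (suc b) * a + T (suc a) b * b + T (suc a) (suc b) * c))
      ≡⟨ rearrange (𝟙 (a ≟ 0) * A (suc b)) (T a (suc b)) (𝟙 (b ≟ 0) * A (suc a)) (T (suc a) b) (T (suc a) (suc b) * c) a b ⟩
    (𝟙 (a ≟ 0) * A (suc b) + T a (suc b) * suc a) + (𝟙 (b ≟ 0) * A (suc a) + T (suc a) b * suc b) + T (suc a) (suc b) * c
      ∎
    where
    open ≡-Reasoning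
    A = pointsOnCycles ρ
    T = pairsOnCycles ρ
    c = n ∸ (a + suc b)
    D : Fin (suc n) → Fin (suc n) → Fin (suc n) → ℕ
    D p = onDistinctCycles (insert ρ p) (suc a) (suc b)
    rearrange : ∀ u t u′ t′ w a b → 0 + (u + t) + (u′ + t′ + (t * a + t′ * b + w)) ≡ u + t * suc a + (u′ + t′ * suc b) + w
    rearrange = solve-∀

∑𝔖-pointsOnCycles-suc : ∀ n a → ∑[ σ ∈𝔖 suc n ] pointsOnCycles σ (suc a) ≡
  𝟙 (a ≟ 0) * n ! + ∑[ σ ∈𝔖 n ] pointsOnCycles σ a * suc a + ∑[ σ ∈𝔖 n ] pointsOnCycles σ (suc a) * (n ∸ a)
∑𝔖-pointsOnCycles-suc n a =
  trans (∑𝔖-cong n (λ ρ → ∑-pointsOnCycles-insert ρ a))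
    (trans (∑𝔖-distrib-+ n (λ ρ → 𝟙 (a ≟ 0) + pointsOnCycles ρ a * suc a) (λ ρ → pointsOnCycles ρ (suc a) * (n ∸ a)))
      (cong₂ _+_ (trans (∑𝔖-distrib-+ n (λ _ → 𝟙 (a ≟ 0)) (λ ρ → pointsOnCycles ρ a * suc a))
                        (cong₂ _+_ (∑𝔖-const n (𝟙 (a ≟ 0))) (sym (*-distribʳ-∑𝔖 n (suc a) (λ ρ → pointsOnCycles ρ a)))))
                 (sym (*-distribʳ-∑𝔖 n (n ∸ a) (λ ρ → pointsOnCycles ρ (suc a))))))

∑𝔖-pairsOnCycles-suc : ∀ n a b → ∑[ σ ∈𝔖 suc n ] pairsOnCycles σ (suc a) (suc b) ≡
  (𝟙 (a ≟ 0) * ∑[ σ ∈𝔖 n ] pointsOnCycles σ (suc b) + ∑[ σ ∈𝔖 n ] pairsOnCycles σ a (suc b) * suc a)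
  + (𝟙 (b ≟ 0) * ∑[ σ ∈𝔖 n ] pointsOnCycles σ (suc a) + ∑[ σ ∈𝔖 n ] pairsOnCycles σ (suc a) b * suc b)
  + ∑[ σ ∈𝔖 n ] pairsOnCycles σ (suc a) (suc b) * (n ∸ (a + suc b))
∑𝔖-pairsOnCycles-suc n a b =
  trans (∑𝔖-cong n (λ ρ → ∑-pairsOnCycles-insert ρ a b))
    (trans (∑𝔖-distrib-+ n _ (λ ρ → pairsOnCycles ρ (suc a) (suc b) * (n ∸ (a + suc b))))
      (cong₂ _+_ (trans (∑𝔖-distrib-+ n _ _)
                        (cong₂ _+_ (linear (𝟙 (a ≟ 0)) (suc a) (λ ρ → pointsOnCycles ρ (suc b)) (λ ρ → pairsOnCycles ρ a (suc b)))
                                   (linear (𝟙 (b ≟ 0)) (suc b) (λ ρ → pointsOnCycles ρ (suc a)) (λ ρ → pairsOnCycles ρ (suc a) b))))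
                 (sym (*-distribʳ-∑𝔖 n (n ∸ (a + suc b)) (λ ρ → pairsOnCycles ρ (suc a) (suc b))))))
  where
  linear : ∀ i s (f g : Permutation′ n → ℕ) → ∑[ ρ ∈𝔖 n ] (i * f ρ + g ρ * s) ≡ i * ∑𝔖 n f + ∑𝔖 n g * s
  linear i s f g = trans (∑𝔖-distrib-+ n (λ ρ → i * f ρ) (λ ρ → g ρ * s))
    (sym (cong₂ _+_ (*-distribˡ-∑𝔖 n i f) (*-distribʳ-∑𝔖 n s g)))

private
  newPoint-≤ : ∀ {F X} a → X ≤ F → (a ≡ 0 → X ≡ 0) → 𝟙 (a ≟ 0) * F + X * suc a ≤ F * suc a
  newPoint-≤ {F} zero    _   X≡0 rewrite X≡0 refl = ≤-reflexive (trans (+-identityʳ (F + 0)) (trans (+-identityʳ F) (sym (*-identityʳ F))))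
  newPoint-≤     (suc a) X≤F _   = *-monoˡ-≤ (suc (suc a)) X≤F

∑𝔖-pointsOnCycles≤! : ∀ n k → ∑[ σ ∈𝔖 n ] pointsOnCycles σ k ≤ n !
∑𝔖-pointsOnCycles≤! zero    k       = z≤n
∑𝔖-pointsOnCycles≤! (suc n) zero    = ≤-trans (≤-reflexive (∑𝔖-zero (suc n) pointsOnCycles-zero)) z≤n
∑𝔖-pointsOnCycles≤! (suc n) (suc a) with a ≤? n
... | no  a≰n = ≤-trans (≤-reflexive (∑𝔖-zero (suc n) λ σ → pointsOnCycles-vanish σ (s≤s (≰⇒> a≰n)))) z≤n
... | yes a≤n = begin
  ∑[ σ ∈𝔖 suc n ] pointsOnCycles σ (suc a)
    ≡⟨ ∑𝔖-pointsOnCycles-suc n a ⟩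
  𝟙 (a ≟ 0) * n ! + ∑[ σ ∈𝔖 n ] pointsOnCycles σ a * suc a + ∑[ σ ∈𝔖 n ] pointsOnCycles σ (suc a) * (n ∸ a)
    ≤⟨ +-mono-≤ (newPoint-≤ a (∑𝔖-pointsOnCycles≤! n a) λ { refl → ∑𝔖-zero n pointsOnCycles-zero })
                (*-monoˡ-≤ (n ∸ a) (∑𝔖-pointsOnCycles≤! n (suc a))) ⟩
  n ! * suc a + n ! * (n ∸ a)
    ≡⟨ trans (sym (*-distribˡ-+ (n !) (suc a) (n ∸ a))) (trans (cong (n ! *_) (cong suc (m+[n∸m]≡n a≤n))) (*-comm (n !) (suc n))) ⟩
  suc n !
    ∎
  where open ≤-Reasoning

∑𝔖-pairsOnCycles≤! : ∀ n k₁ k₂ → ∑[ σ ∈𝔖 n ] pairsOnCycles σ k₁ k₂ ≤ n !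
∑𝔖-pairsOnCycles≤! zero    k₁      k₂      = z≤n
∑𝔖-pairsOnCycles≤! (suc n) zero    k₂      = ≤-trans (≤-reflexive (∑𝔖-zero (suc n) λ σ → pairsOnCycles-zeroˡ σ k₂)) z≤n
∑𝔖-pairsOnCycles≤! (suc n) (suc a) zero    =
  ≤-trans (≤-reflexive (∑𝔖-zero (suc n) λ σ → trans (pairsOnCycles-sym σ (suc a) 0) (pairsOnCycles-zeroˡ σ (suc a)))) z≤n
∑𝔖-pairsOnCycles≤! (suc n) (suc a) (suc b) with a + suc b ≤? n
... | no  a+sb≰n = ≤-trans (≤-reflexive (∑𝔖-zero (suc n) λ σ → pairsOnCycles-vanish σ {suc a} {suc b} (s≤s (≰⇒> a+sb≰n)))) z≤n
... | yes a+sb≤n = begin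
  ∑[ σ ∈𝔖 suc n ] pairsOnCycles σ (suc a) (suc b)
    ≡⟨ ∑𝔖-pairsOnCycles-suc n a b ⟩
  (𝟙 (a ≟ 0) * 𝔼A (suc b) + 𝔼T a (suc b) * suc a) + (𝟙 (b ≟ 0) * 𝔼A (suc a) + 𝔼T (suc a) b * suc b) + 𝔼T (suc a) (suc b) * c
    ≤⟨ +-mono-≤ (+-mono-≤ (newPoint a (suc b) (∑𝔖-pairsOnCycles≤! n a (suc b)) λ { refl → 𝔼T-zeroˡ (suc b) })
                          (newPoint b (suc a) (∑𝔖-pairsOnCycles≤! n (suc a) b)
                                    λ { refl → trans (∑𝔖-cong n λ σ → pairsOnCycles-sym σ (suc a) 0) (𝔼T-zeroˡ (suc a)) }))
                (*-monoˡ-≤ c (∑𝔖-pairsOnCycles≤! n (suc a) (suc b))) ⟩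
  n ! * suc a + n ! * suc b + n ! * c
    ≡⟨ trans (sym (trans (*-distribˡ-+ (n !) (suc a + suc b) c) (cong (_+ n ! * c) (*-distribˡ-+ (n !) (suc a) (suc b)))))
             (trans (cong (n ! *_) total) (*-comm (n !) (suc n))) ⟩
  suc n !
    ∎
  where
  open ≤-Reasoning
  𝔼A = λ k → ∑[ σ ∈𝔖 n ] pointsOnCycles σ k
  𝔼T = λ k₁ k₂ → ∑[ σ ∈𝔖 n ] pairsOnCycles σ k₁ k₂
  c = n ∸ (a + suc b)
  𝔼T-zeroˡ : ∀ k → 𝔼T 0 k ≡ 0
  𝔼T-zeroˡ k = ∑𝔖-zero n λ σ → pairsOnCycles-zeroˡ σ k
  newPoint : ∀ a k {X} → X ≤ n ! → (a ≡ 0 → X ≡ 0) → 𝟙 (a ≟ 0) * 𝔼A k + X * suc a ≤ n ! * suc a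
  newPoint a k X≤ X≡0 = ≤-trans (+-monoˡ-≤ _ (*-monoʳ-≤ (𝟙 (a ≟ 0)) (∑𝔖-pointsOnCycles≤! n k))) (newPoint-≤ a X≤ X≡0)
  total : suc a + suc b + c ≡ suc n
  total = trans (cong suc (trans (+-assoc a (suc b) c) (sym (+-assoc a (suc b) c)))) (cong suc (m+[n∸m]≡n a+sb≤n))

-- Dyadic weights

lg : ℕ → ℕ
lg zero    = 0
lg (suc m) with 2 ^ suc (lg m) ≤? suc m
... | yes _ = suc (lg m)
... | no  _ = lg m

lg-spec : ∀ m → 1 ≤ m → 2 ^ lg m ≤ m × m < 2 ^ suc (lg m)
lg-spec (suc zero)    _ = s≤s z≤n , s≤s (s≤s z≤n)
lg-spec (suc (suc m)) _ with lg-spec (suc m) (s≤s z≤n) | 2 ^ suc (lg (suc m)) ≤? suc (suc m)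
... | _ , m<2^ | yes 2^≤ = 2^≤ , (begin-strict
  suc (suc m)               <⟨ s≤s m<2^ ⟩
  suc (2 ^ suc (lg (suc m))) ≡⟨ +-comm 1 (2 ^ suc (lg (suc m))) ⟩
  2 ^ suc (lg (suc m)) + 1  ≤⟨ +-monoʳ-≤ (2 ^ suc (lg (suc m))) (m^n>0 2 (suc (lg (suc m)))) ⟩
  2 ^ suc (lg (suc m)) + 2 ^ suc (lg (suc m)) ≡⟨ cong (2 ^ suc (lg (suc m)) +_) (+-identityʳ _) ⟨
  2 ^ suc (suc (lg (suc m))) ∎)
  where open ≤-Reasoning
... | 2^≤ , _ | no  2^≰ = m≤n⇒m≤1+n 2^≤ , ≰⇒> 2^≰

private
  2^-reflect-< : ∀ {a b} → 2 ^ a < 2 ^ suc b → a ≤ b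
  2^-reflect-< {a} {b} lt with a ≤? b
  ... | yes a≤b = a≤b
  ... | no  a≰b = contradiction (^-monoʳ-≤ 2 (≰⇒> a≰b)) (<⇒≱ lt)

2^≤⇒≤lg : ∀ {m j} → 2 ^ j ≤ m → j ≤ lg m
2^≤⇒≤lg {m} {j} 2^≤m = 2^-reflect-< (≤-<-trans 2^≤m (proj₂ (lg-spec m (≤-trans (m^n>0 2 j) 2^≤m))))

<2^⇒lg≤ : ∀ {m S} → m < 2 ^ suc S → lg m ≤ S
<2^⇒lg≤ {zero}  _    = z≤n
<2^⇒lg≤ {suc m} m<2^ = 2^-reflect-< (≤-<-trans (proj₁ (lg-spec (suc m) (s≤s z≤n))) m<2^)

lg-unique : ∀ {m j} → 2 ^ j ≤ m → m < 2 ^ suc j → lg m ≡ j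
lg-unique 2^≤m m<2^ = ≤-antisym (<2^⇒lg≤ m<2^) (2^≤⇒≤lg 2^≤m)

n<2^n : ∀ n → n < 2 ^ n
n<2^n zero    = s≤s z≤n
n<2^n (suc n) = begin-strict
  suc n            ≡⟨ +-comm 1 n ⟩
  n + 1            <⟨ +-mono-<-≤ (n<2^n n) (m^n>0 2 n) ⟩
  2 ^ n + 2 ^ n    ≡⟨ cong (2 ^ n +_) (+-identityʳ (2 ^ n)) ⟨
  2 ^ suc n        ∎
  where open ≤-Reasoning

∑-dyadic : ∀ J (h : ℕ → ℕ) → ∑[ i < 2 ^ J ] h (lg (toℕ i)) ≡ h 0 + ∑[ j < J ] (2 ^ toℕ j * h (toℕ j))
∑-dyadic zero    h = refl
∑-dyadic (suc J) h = begin
  ∑[ i < 2 ^ J + (2 ^ J + 0) ] h (lg (toℕ i))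
    ≡⟨ ∑-toℕ-+ (2 ^ J) (2 ^ J + 0) (h ∘ lg) ⟩
  ∑[ i < 2 ^ J ] h (lg (toℕ i)) + ∑[ t < 2 ^ J + 0 ] h (lg (2 ^ J + toℕ t))
    ≡⟨ cong₂ _+_ (∑-dyadic J h) (sum-cong-≗ {2 ^ J + 0} λ t → cong h (lg-unique (m≤m+n (2 ^ J) (toℕ t)) (+-monoʳ-< (2 ^ J) (F.toℕ<n t)))) ⟩
  h 0 + ∑[ j < J ] (2 ^ toℕ j * h (toℕ j)) + ∑[ t < 2 ^ J + 0 ] h J
    ≡⟨ cong (h 0 + ∑[ j < J ] (2 ^ toℕ j * h (toℕ j)) +_) (trans (∑-const (2 ^ J + 0) (h J)) (cong (_* h J) (+-identityʳ (2 ^ J)))) ⟩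
  h 0 + ∑[ j < J ] (2 ^ toℕ j * h (toℕ j)) + 2 ^ J * h J
    ≡⟨ +-assoc (h 0) _ _ ⟩
  h 0 + (∑[ j < J ] (2 ^ toℕ j * h (toℕ j)) + 2 ^ J * h J)
    ≡⟨ cong (h 0 +_) (sym (trans (sum-init-last {J} (λ j → 2 ^ toℕ j * h (toℕ j)))
         (cong₂ _+_ (sum-cong-≗ {J} λ j → cong (λ k → 2 ^ k * h k) (F.toℕ-inject₁ j)) (cong (λ k → 2 ^ k * h k) (F.toℕ-fromℕ J))))) ⟩
  h 0 + ∑[ j < suc J ] (2 ^ toℕ j * h (toℕ j))
    ∎
  where open ≡-Reasoning

∑-2^-∸ : ∀ m E → m ≤ suc E → ∑[ j < m ] (2 ^ (E ∸ toℕ j)) ≤ 2 ^ suc E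
∑-2^-∸ zero          E       _         = z≤n
∑-2^-∸ (suc zero)    zero    _         = s≤s z≤n
∑-2^-∸ (suc m)       (suc E) (s≤s m≤E) = begin
  2 ^ suc E + ∑[ j < m ] (2 ^ (E ∸ toℕ j))  ≤⟨ +-monoʳ-≤ (2 ^ suc E) (∑-2^-∸ m E m≤E) ⟩
  2 ^ suc E + 2 ^ suc E                    ≡⟨ cong (2 ^ suc E +_) (+-identityʳ _) ⟨
  2 ^ suc (suc E)                          ∎
  where open ≤-Reasoning

∑-2^-∸-from : ∀ U m E → m ≤ suc E → ∑[ j < m ] (𝟙 (U ≤? toℕ j) * 2 ^ (E ∸ toℕ j)) * 2 ^ U ≤ 2 ^ suc E
∑-2^-∸-from zero     m       E m≤sE = begin
  ∑[ j < m ] (𝟙 (0 ≤? toℕ j) * 2 ^ (E ∸ toℕ j)) * 1  ≡⟨ *-identityʳ _ ⟩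
  ∑[ j < m ] (𝟙 (0 ≤? toℕ j) * 2 ^ (E ∸ toℕ j))      ≡⟨ sum-cong-≗ {m} (λ j → +-identityʳ (2 ^ (E ∸ toℕ j))) ⟩
  ∑[ j < m ] (2 ^ (E ∸ toℕ j))                        ≤⟨ ∑-2^-∸ m E m≤sE ⟩
  2 ^ suc E                                           ∎
  where open ≤-Reasoning
∑-2^-∸-from (suc U) zero    E       _           = z≤n
∑-2^-∸-from (suc U) (suc m) zero    (s≤s z≤n)   = z≤n
∑-2^-∸-from (suc U) (suc m) (suc E) (s≤s m≤sE) = begin
  ∑[ j < m ] (𝟙 (suc U ≤? suc (toℕ j)) * 2 ^ (E ∸ toℕ j)) * (2 * 2 ^ U)
    ≡⟨ cong (_* (2 * 2 ^ U)) (sum-cong-≗ {m} λ j → cong (_* 2 ^ (E ∸ toℕ j)) (𝟙-cong (suc U ≤? suc (toℕ j)) (U ≤? toℕ j) s≤s⁻¹ s≤s)) ⟩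
  ∑[ j < m ] (𝟙 (U ≤? toℕ j) * 2 ^ (E ∸ toℕ j)) * (2 * 2 ^ U)
    ≡⟨ rearrange (∑[ j < m ] (𝟙 (U ≤? toℕ j) * 2 ^ (E ∸ toℕ j))) (2 ^ U) ⟩
  2 * (∑[ j < m ] (𝟙 (U ≤? toℕ j) * 2 ^ (E ∸ toℕ j)) * 2 ^ U)
    ≤⟨ *-monoʳ-≤ 2 (∑-2^-∸-from U m E m≤sE) ⟩
  2 * 2 ^ suc E
    ∎
  where
  open ≤-Reasoning
  rearrange : ∀ s u → s * (2 * u) ≡ 2 * (s * u)
  rearrange = solve-∀

-- μ S a ≈ 2^S / a and ν U S l ≈ 4^S / l² for l ≥ 2^U, rounded to powers of two.
μ : ℕ → ℕ → ℕ
μ S a = 2 ^ (S ∸ lg a)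

ν : ℕ → ℕ → ℕ → ℕ
ν U S l = 𝟙 (U ≤? lg l) * 2 ^ (2 * (S ∸ lg l))

∑μ : ∀ S → ∑[ a < 2 ^ suc S ] μ S (toℕ a) ≡ suc (suc S) * 2 ^ S
∑μ S = begin
  ∑[ a < 2 ^ suc S ] μ S (toℕ a)                      ≡⟨ ∑-dyadic (suc S) (λ j → 2 ^ (S ∸ j)) ⟩
  2 ^ S + ∑[ j < suc S ] (2 ^ toℕ j * 2 ^ (S ∸ toℕ j))  ≡⟨ cong (2 ^ S +_) (sum-cong-≗ {suc S} λ j → split (s≤s⁻¹ (F.toℕ<n j))) ⟩
  2 ^ S + ∑[ j < suc S ] (2 ^ S)                      ≡⟨ cong (2 ^ S +_) (∑-const (suc S) (2 ^ S)) ⟩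
  suc (suc S) * 2 ^ S                                 ∎
  where
  open ≡-Reasoning
  split : ∀ {j} → j ≤ S → 2 ^ j * 2 ^ (S ∸ j) ≡ 2 ^ S
  split {j} j≤S = trans (sym (^-distribˡ-+-* 2 j (S ∸ j))) (cong (2 ^_) (m+[n∸m]≡n j≤S))

∑ν : ∀ {U} S → 1 ≤ U → ∑[ l < 2 ^ suc S ] ν U S (toℕ l) * 2 ^ U ≤ 2 ^ S * 2 ^ suc S
∑ν {U} S U≥1 = begin
  ∑[ l < 2 ^ suc S ] ν U S (toℕ l) * 2 ^ U
    ≡⟨ cong (_* 2 ^ U) (∑-dyadic (suc S) h) ⟩
  (h 0 + ∑[ j < suc S ] (2 ^ toℕ j * h (toℕ j))) * 2 ^ U
    ≡⟨ cong (λ x → (x + ∑[ j < suc S ] (2 ^ toℕ j * h (toℕ j))) * 2 ^ U) h0≡0 ⟩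
  ∑[ j < suc S ] (2 ^ toℕ j * h (toℕ j)) * 2 ^ U
    ≡⟨ cong (_* 2 ^ U) (trans (sum-cong-≗ {suc S} λ j → split (s≤s⁻¹ (F.toℕ<n j))) (sym (*-distribˡ-sum (2 ^ S) g))) ⟩
  2 ^ S * ∑[ j < suc S ] g j * 2 ^ U
    ≡⟨ *-assoc (2 ^ S) _ (2 ^ U) ⟩
  2 ^ S * (∑[ j < suc S ] g j * 2 ^ U)
    ≤⟨ *-monoʳ-≤ (2 ^ S) (∑-2^-∸-from U (suc S) S ≤-refl) ⟩
  2 ^ S * 2 ^ suc S
    ∎
  where
  open ≤-Reasoning
  h : ℕ → ℕ
  h j = 𝟙 (U ≤? j) * 2 ^ (2 * (S ∸ j))
  g : Fin (suc S) → ℕ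
  g j = 𝟙 (U ≤? toℕ j) * 2 ^ (S ∸ toℕ j)
  h0≡0 : h 0 ≡ 0
  h0≡0 = cong (_* 2 ^ (2 * S)) (𝟙-no (U ≤? 0) (<⇒≱ U≥1))
  split : ∀ {j} → j ≤ S → 2 ^ j * h j ≡ 2 ^ S * (𝟙 (U ≤? j) * 2 ^ (S ∸ j))
  split {j} j≤S = begin-equality
    2 ^ j * (𝟙 (U ≤? j) * 2 ^ (2 * (S ∸ j)))   ≡⟨ rearrange (2 ^ j) (𝟙 (U ≤? j)) (2 ^ (2 * (S ∸ j))) ⟩
    𝟙 (U ≤? j) * (2 ^ j * 2 ^ (2 * (S ∸ j)))   ≡⟨ cong (𝟙 (U ≤? j) *_) (trans (sym (^-distribˡ-+-* 2 j _)) (cong (2 ^_) exponent)) ⟩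
    𝟙 (U ≤? j) * 2 ^ (S + (S ∸ j))             ≡⟨ cong (𝟙 (U ≤? j) *_) (^-distribˡ-+-* 2 S (S ∸ j)) ⟩
    𝟙 (U ≤? j) * (2 ^ S * 2 ^ (S ∸ j))         ≡⟨ rearrange (𝟙 (U ≤? j)) (2 ^ S) (2 ^ (S ∸ j)) ⟩
    2 ^ S * (𝟙 (U ≤? j) * 2 ^ (S ∸ j))         ∎
    where
    rearrange : ∀ x y z → x * (y * z) ≡ y * (x * z)
    rearrange = solve-∀
    exponent : j + 2 * (S ∸ j) ≡ S + (S ∸ j)
    exponent = trans (e j (S ∸ j)) (cong (_+ (S ∸ j)) (m+[n∸m]≡n j≤S))
      where e : ∀ j t → j + 2 * t ≡ j + t + t
            e = solve-∀

2^S≤μ* : ∀ {S a} → 1 ≤ a → lg a ≤ S → 2 ^ S ≤ μ S a * a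
2^S≤μ* {S} {a} a≥1 lga≤S = begin
  2 ^ S                         ≡⟨ cong (2 ^_) (m∸n+n≡m lga≤S) ⟨
  2 ^ (S ∸ lg a + lg a)         ≡⟨ ^-distribˡ-+-* 2 (S ∸ lg a) (lg a) ⟩
  2 ^ (S ∸ lg a) * 2 ^ lg a     ≤⟨ *-monoʳ-≤ (2 ^ (S ∸ lg a)) (proj₁ (lg-spec a a≥1)) ⟩
  μ S a * a                     ∎
  where open ≤-Reasoning

2^S*2^S≤ν* : ∀ {U S l} → 1 ≤ l → U ≤ lg l → lg l ≤ S → 2 ^ S * 2 ^ S ≤ ν U S l * (l * l)
2^S*2^S≤ν* {U} {S} {l} l≥1 U≤lgl lgl≤S = begin
  2 ^ S * 2 ^ S                                  ≡⟨ cong (λ k → 2 ^ k * 2 ^ k) (m∸n+n≡m lgl≤S) ⟨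
  2 ^ (t + lg l) * 2 ^ (t + lg l)                ≡⟨ cong₂ _*_ (^-distribˡ-+-* 2 t (lg l)) (^-distribˡ-+-* 2 t (lg l)) ⟩
  2 ^ t * 2 ^ lg l * (2 ^ t * 2 ^ lg l)          ≡⟨ rearrange (2 ^ t) (2 ^ lg l) ⟩
  2 ^ t * 2 ^ t * (2 ^ lg l * 2 ^ lg l)          ≡⟨ cong (_* (2 ^ lg l * 2 ^ lg l)) 2^2t ⟨
  2 ^ (2 * t) * (2 ^ lg l * 2 ^ lg l)            ≤⟨ *-monoʳ-≤ (2 ^ (2 * t)) (*-mono-≤ 2^lg≤l 2^lg≤l) ⟩
  2 ^ (2 * t) * (l * l)                          ≡⟨ cong (_* (l * l)) (+-identityʳ (2 ^ (2 * t))) ⟨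
  (2 ^ (2 * t) + 0) * (l * l)                    ≡⟨ cong (λ i → i * 2 ^ (2 * t) * (l * l)) (𝟙-yes (U ≤? lg l) U≤lgl) ⟨
  ν U S l * (l * l)                              ∎
  where
  open ≤-Reasoning
  t = S ∸ lg l
  2^lg≤l = proj₁ (lg-spec l l≥1)
  rearrange : ∀ x y → x * y * (x * y) ≡ x * x * (y * y)
  rearrange = solve-∀
  2^2t : 2 ^ (2 * t) ≡ 2 ^ t * 2 ^ t
  2^2t = trans (cong (λ k → 2 ^ (t + k)) (+-identityʳ t)) (^-distribˡ-+-* 2 t t)

-- The threshold log³ n

^-distribʳ-* : ∀ m n k → (m * n) ^ k ≡ m ^ k * n ^ k
^-distribʳ-* m n zero    = refl
^-distribʳ-* m n (suc k) = trans (cong (m * n *_) (^-distribʳ-* m n k)) (rearrange m n (m ^ k) (n ^ k))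
  where
  rearrange : ∀ m n a b → m * n * (a * b) ≡ m * a * (n * b)
  rearrange = solve-∀

bernoulli : ∀ M j → M ^ j * (M + j) ≤ suc M ^ j * M
bernoulli M zero    = ≤-reflexive (cong (_+ 0) (+-identityʳ M))
bernoulli M (suc j) = begin
  M * M ^ j * (M + suc j)       ≡⟨ rearrange M (M ^ j) j ⟩
  M ^ j * (M * (M + j) + M)     ≤⟨ *-monoʳ-≤ (M ^ j) (+-monoʳ-≤ (M * (M + j)) (m≤m+n M j)) ⟩
  M ^ j * (M * (M + j) + (M + j))  ≡⟨ rearrange′ M (M ^ j) j ⟩
  suc M * (M ^ j * (M + j))     ≤⟨ *-monoʳ-≤ (suc M) (bernoulli M j) ⟩
  suc M * (suc M ^ j * M)       ≡⟨ *-assoc (suc M) (suc M ^ j) M ⟨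
  suc M * suc M ^ j * M         ∎
  where
  open ≤-Reasoning
  rearrange : ∀ M a j → M * a * (M + suc j) ≡ a * (M * (M + j) + M)
  rearrange = solve-∀
  rearrange′ : ∀ M a j → a * (M * (M + j) + (M + j)) ≡ suc M * (a * (M + j))
  rearrange′ = solve-∀

bernoulli⁻ : ∀ M j → j ≤ suc M → suc M ^ j * (suc M ∸ j) ≤ M ^ j * suc M
bernoulli⁻ M zero    _    = ≤-refl
bernoulli⁻ M (suc j) j<sM = begin
  suc M * suc M ^ j * (suc M ∸ suc j)     ≡⟨ rearrange (suc M) (suc M ^ j) (M ∸ j) ⟩
  suc M * (M ∸ j) * suc M ^ j             ≤⟨ *-monoˡ-≤ (suc M ^ j) step ⟩
  M * (suc M ∸ j) * suc M ^ j             ≡⟨ rearrange′ M (suc M ∸ j) (suc M ^ j) ⟩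
  M * (suc M ^ j * (suc M ∸ j))           ≤⟨ *-monoʳ-≤ M (bernoulli⁻ M j (<⇒≤ j<sM)) ⟩
  M * (M ^ j * suc M)                     ≡⟨ *-assoc M (M ^ j) (suc M) ⟨
  M * M ^ j * suc M                       ∎
  where
  open ≤-Reasoning
  rearrange : ∀ a b c → a * b * c ≡ a * c * b
  rearrange = solve-∀
  rearrange′ : ∀ m a b → m * a * b ≡ m * (b * a)
  rearrange′ = solve-∀
  step : suc M * (M ∸ j) ≤ M * (suc M ∸ j)
  step = subst (λ M → suc M * (M ∸ j) ≤ M * (suc M ∸ j)) (m+[n∸m]≡n (s≤s⁻¹ j<sM)) (core (M ∸ j))
    where
    core : ∀ t → suc (j + t) * (j + t ∸ j) ≤ (j + t) * (suc (j + t) ∸ j)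
    core t rewrite m+n∸m≡n j t | sym (+-suc j t) | m+n∸m≡n j (suc t) =
      ≤-trans (m≤m+n (suc (j + t) * t) j) (≤-reflexive (rearrange″ j t))
      where
      rearrange″ : ∀ j t → suc (j + t) * t + j ≡ (j + t) * suc t
      rearrange″ = solve-∀

[1+2K]^K≤2*[2K]^K : ∀ K → suc (2 * K) ^ K ≤ 2 * (2 * K) ^ K
[1+2K]^K≤2*[2K]^K K = *-cancelʳ-≤ (suc (2 * K) ^ K) (2 * (2 * K) ^ K) (suc K) (begin
  suc (2 * K) ^ K * suc K               ≡⟨ cong (suc (2 * K) ^ K *_) 1+2K∸K ⟨
  suc (2 * K) ^ K * (suc (2 * K) ∸ K)   ≤⟨ bernoulli⁻ (2 * K) K (≤-trans (m≤m+n K (K + 0)) (n≤1+n _)) ⟩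
  (2 * K) ^ K * suc (2 * K)             ≤⟨ *-monoʳ-≤ ((2 * K) ^ K) (≤-trans (n≤1+n _) (≤-reflexive (2+2K K))) ⟩
  (2 * K) ^ K * (2 * suc K)             ≡⟨ rearrange ((2 * K) ^ K) K ⟩
  2 * (2 * K) ^ K * suc K               ∎)
  where
  open ≤-Reasoning
  1+2K∸K : suc (2 * K) ∸ K ≡ suc K
  1+2K∸K = trans (cong (_∸ K) (sym (+-suc K (K + 0)))) (trans (m+n∸m≡n K (suc (K + 0))) (cong suc (+-identityʳ K)))
  rearrange : ∀ x K → x * (2 * suc K) ≡ 2 * x * suc K
  rearrange = solve-∀
  2+2K : ∀ K → suc (suc (2 * K)) ≡ 2 * suc K
  2+2K = solve-∀

-- (1 + Q/K)^K ≤ (1 + 1/2K)^(2K·Q) ≤ 4^Q, by Bernoulli's inequality in both directions.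
[K+Q]^K≤4^Q*K^K : ∀ K Q → (K + Q) ^ K ≤ 2 ^ (2 * Q) * K ^ K
[K+Q]^K≤4^Q*K^K zero    Q = ≤-trans (m^n>0 2 (2 * Q)) (≤-reflexive (sym (*-identityʳ (2 ^ (2 * Q)))))
[K+Q]^K≤4^Q*K^K (suc k) Q = *-cancelˡ-≤ (X ^ K) {{X^K≢0}} (begin
  X ^ K * (K + Q) ^ K                   ≡⟨ ^-distribʳ-* X (K + Q) K ⟨
  (X * (K + Q)) ^ K                     ≤⟨ ^-monoˡ-≤ K bernoulli′ ⟩
  (Y * K) ^ K                           ≡⟨ ^-distribʳ-* Y K K ⟩
  Y ^ K * K ^ K                         ≡⟨ cong (_* K ^ K) (^-swap (suc (2 * K)) (2 * Q) K) ⟩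
  (suc (2 * K) ^ K) ^ (2 * Q) * K ^ K   ≤⟨ *-monoˡ-≤ (K ^ K) (^-monoˡ-≤ (2 * Q) ([1+2K]^K≤2*[2K]^K K)) ⟩
  (2 * (2 * K) ^ K) ^ (2 * Q) * K ^ K   ≡⟨ cong (_* K ^ K) (^-distribʳ-* 2 ((2 * K) ^ K) (2 * Q)) ⟩
  2 ^ (2 * Q) * ((2 * K) ^ K) ^ (2 * Q) * K ^ K  ≡⟨ cong (λ z → 2 ^ (2 * Q) * z * K ^ K) (^-swap (2 * K) K (2 * Q)) ⟩
  2 ^ (2 * Q) * X ^ K * K ^ K           ≡⟨ rearrange (2 ^ (2 * Q)) (X ^ K) (K ^ K) ⟩
  X ^ K * (2 ^ (2 * Q) * K ^ K)         ∎)
  where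
  open ≤-Reasoning
  K = suc k
  X = (2 * K) ^ (2 * Q)
  Y = suc (2 * K) ^ (2 * Q)
  X^K≢0 : NonZero (X ^ K)
  X^K≢0 = >-nonZero (m^n>0 X {{>-nonZero (m^n>0 (2 * K) (2 * Q))}} K)
  ^-swap : ∀ x a b → (x ^ a) ^ b ≡ (x ^ b) ^ a
  ^-swap x a b = trans (^-*-assoc x a b) (trans (cong (x ^_) (*-comm a b)) (sym (^-*-assoc x b a)))
  bernoulli′ : X * (K + Q) ≤ Y * K
  bernoulli′ = *-cancelˡ-≤ 2 (begin
    2 * (X * (K + Q))          ≡⟨ rearrange′ X K Q ⟩
    X * (2 * K + 2 * Q)        ≤⟨ bernoulli (2 * K) (2 * Q) ⟩
    Y * (2 * K)                ≡⟨ rearrange″ Y K ⟩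
    2 * (Y * K)                ∎)
    where
    rearrange′ : ∀ x K Q → 2 * (x * (K + Q)) ≡ x * (2 * K + 2 * Q)
    rearrange′ = solve-∀
    rearrange″ : ∀ y K → y * (2 * K) ≡ 2 * (y * K)
    rearrange″ = solve-∀
  rearrange : ∀ a b c → a * b * c ≡ b * (a * c)
  rearrange = solve-∀

-- With q = a/d: n < (1 + q/K)^K ≤ 4^(⌊q⌋ + 1) forces S ≤ 2⌊q⌋ + 1, while ⌊q⌋³ ≤ q³ < l.
LogCubeLt⇒[S∸1]^3<8* : ∀ {n l S} → 2 ^ S ≤ n → LogCubeLt n l → (S ∸ 1) ^ 3 < 8 * l
LogCubeLt⇒[S∸1]^3<8* {n} {l} {S} 2^S≤n (a , c , k , a³<ld³ , n<[Kd+a]^K) = begin-strict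
  (S ∸ 1) ^ 3   ≤⟨ ^-monoˡ-≤ 3 S∸1≤2m ⟩
  (2 * m) ^ 3   ≡⟨ ^-distribʳ-* 2 m 3 ⟩
  8 * m ^ 3     <⟨ *-monoʳ-< 8 m³<l ⟩
  8 * l         ∎
  where
  open ≤-Reasoning
  d = suc c
  K = suc k
  m = a / d
  Q = suc m
  a<Qd : a < Q * d
  a<Qd = begin-strict
    a                  ≡⟨ m≡m%n+[m/n]*n a d ⟩
    a % d + m * d      <⟨ +-monoˡ-< (m * d) (m%n<n a d) ⟩
    d + m * d          ∎
  n<4^Q : n < 2 ^ (2 * Q)
  n<4^Q = *-cancelʳ-< ((K * d) ^ K) n (2 ^ (2 * Q)) (begin-strict
    n * (K * d) ^ K            <⟨ n<[Kd+a]^K ⟩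
    (K * d + a) ^ K            ≤⟨ ^-monoˡ-≤ K (≤-trans (+-monoʳ-≤ (K * d) (<⇒≤ a<Qd)) (≤-reflexive (sym (*-distribʳ-+ d K Q)))) ⟩
    ((K + Q) * d) ^ K          ≡⟨ ^-distribʳ-* (K + Q) d K ⟩
    (K + Q) ^ K * d ^ K        ≤⟨ *-monoˡ-≤ (d ^ K) ([K+Q]^K≤4^Q*K^K K Q) ⟩
    2 ^ (2 * Q) * K ^ K * d ^ K    ≡⟨ trans (*-assoc (2 ^ (2 * Q)) (K ^ K) (d ^ K)) (cong (2 ^ (2 * Q) *_) (sym (^-distribʳ-* K d K))) ⟩
    2 ^ (2 * Q) * (K * d) ^ K  ∎)
  S∸1≤2m : S ∸ 1 ≤ 2 * m
  S∸1≤2m with 2 * Q ≤? S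
  ... | yes 2Q≤S = contradiction (≤-trans (^-monoʳ-≤ 2 2Q≤S) 2^S≤n) (<⇒≱ n<4^Q)
  ... | no  2Q≰S = ∸-monoˡ-≤ 1 (s≤s⁻¹ (subst (S <_) (2*suc m) (≰⇒> 2Q≰S)))
    where
    2*suc : ∀ m → 2 * suc m ≡ suc (suc (2 * m))
    2*suc = solve-∀
  m³<l : m ^ 3 < l
  m³<l = *-cancelʳ-< (d ^ 3) (m ^ 3) l (begin-strict
    m ^ 3 * d ^ 3   ≡⟨ ^-distribʳ-* m d 3 ⟨
    (m * d) ^ 3     ≤⟨ ^-monoˡ-≤ 3 (m/n*n≤m a d) ⟩
    a ^ 3           <⟨ a³<ld³ ⟩
    l * d ^ 3       ∎)

2^[3r∸3]<l : ∀ {r x l} → 1 ≤ r → 2 ^ r ≤ x → x ^ 3 < 8 * l → 2 ^ (3 * r ∸ 3) < l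
2^[3r∸3]<l {r} {x} {l} r≥1 2^r≤x x³<8l = *-cancelˡ-< 8 (2 ^ (3 * r ∸ 3)) l (begin-strict
  8 * 2 ^ (3 * r ∸ 3)     ≡⟨ ^-distribˡ-+-* 2 3 (3 * r ∸ 3) ⟨
  2 ^ (3 + (3 * r ∸ 3))   ≡⟨ cong (2 ^_) (m+[n∸m]≡n (*-monoʳ-≤ 3 r≥1)) ⟩
  2 ^ (3 * r)             ≡⟨ cong (2 ^_) (*-comm 3 r) ⟩
  2 ^ (r * 3)             ≡⟨ ^-*-assoc 2 r 3 ⟨
  (2 ^ r) ^ 3             ≤⟨ ^-monoˡ-≤ 3 2^r≤x ⟩
  x ^ 3                   <⟨ x³<8l ⟩
  8 * l                   ∎)
  where open ≤-Reasoning

-- Bad permutations are rare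

weight : ∀ {n} → ℕ → ℕ → Permutation′ n → ℕ
weight {n} U S σ =
  ∑[ l < suc n ] (ν U S (toℕ l) * ∑[ a < suc n ] (μ S (toℕ a) * ∑[ c < suc n ] (μ S (toℕ c) *
    pairsOnCycles σ (toℕ a * toℕ l) (toℕ c * toℕ l))))

weight-resp-≈ : ∀ {n} U S {σ τ : Permutation′ n} → σ ≈ τ → weight U S σ ≡ weight U S τ
weight-resp-≈ {n} U S {σ} {τ} σ≈τ = sum-cong-≗ {suc n} λ l → cong (ν U S (toℕ l) *_) (sum-cong-≗ {suc n} λ a → cong (μ S (toℕ a) *_)
  (sum-cong-≗ {suc n} λ c → cong (μ S (toℕ c) *_) (pairsOnCycles-resp-≈ {σ = σ} {τ} σ≈τ (toℕ a * toℕ l) (toℕ c * toℕ l))))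

∑𝔖-weight-≤ : ∀ {n} U S → ∑[ σ ∈𝔖 n ] weight U S σ ≤
  ∑[ l < suc n ] ν U S (toℕ l) * (∑[ a < suc n ] μ S (toℕ a) * (∑[ c < suc n ] μ S (toℕ c) * n !))
∑𝔖-weight-≤ {n} U S =
  ∑𝔖-∑-weighted-≤ n (suc n) (λ l → ν U S (toℕ l))
    (λ σ l → ∑[ a < suc n ] (μ S (toℕ a) * ∑[ c < suc n ] (μ S (toℕ c) * pairsOnCycles σ (toℕ a * toℕ l) (toℕ c * toℕ l)))) λ l →
  ∑𝔖-∑-weighted-≤ n (suc n) (λ a → μ S (toℕ a))
    (λ σ a → ∑[ c < suc n ] (μ S (toℕ c) * pairsOnCycles σ (toℕ a * toℕ l) (toℕ c * toℕ l))) λ a →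
  ∑𝔖-∑-weighted-≤ n (suc n) (λ c → μ S (toℕ c))
    (λ σ c → pairsOnCycles σ (toℕ a * toℕ l) (toℕ c * toℕ l)) λ c →
  ∑𝔖-pairsOnCycles≤! n (toℕ a * toℕ l) (toℕ c * toℕ l)

term≤weight : ∀ {n} U S (σ : Permutation′ n) {a c l} → a ≤ n → c ≤ n → l ≤ n →
  ν U S l * (μ S a * (μ S c * pairsOnCycles σ (a * l) (c * l))) ≤ weight U S σ
term≤weight {n} U S σ {a} {c} {l} a≤n c≤n l≤n = begin
  ν U S l * (μ S a * (μ S c * P a c l))  ≤⟨ *-monoʳ-≤ (ν U S l) (*-monoʳ-≤ (μ S a) (term≤∑-toℕ (λ c′ → μ S c′ * P a c′ l) (s≤s c≤n))) ⟩
  ν U S l * (μ S a * ∑c a l)             ≤⟨ *-monoʳ-≤ (ν U S l) (term≤∑-toℕ (λ a′ → μ S a′ * ∑c a′ l) (s≤s a≤n)) ⟩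
  ν U S l * ∑a l                         ≤⟨ term≤∑-toℕ (λ l′ → ν U S l′ * ∑a l′) (s≤s l≤n) ⟩
  weight U S σ                           ∎
  where
  open ≤-Reasoning
  P : ℕ → ℕ → ℕ → ℕ
  P a c l = pairsOnCycles σ (a * l) (c * l)
  ∑c : ℕ → ℕ → ℕ
  ∑c a l = ∑[ c′ < suc n ] (μ S (toℕ c′) * P a (toℕ c′) l)
  ∑a : ℕ → ℕ
  ∑a l = ∑[ a′ < suc n ] (μ S (toℕ a′) * ∑c (toℕ a′) l)

module _ {n S r : ℕ} (2^S≤n : 2 ^ S ≤ n) (n<2^S⁺ : n < 2 ^ suc S) (r≥2 : 2 ≤ r) (2^r≤S∸1 : 2 ^ r ≤ S ∸ 1) where

  private
    U = 3 * r ∸ 3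

  Bad⇒weight≥ : ∀ {σ} → Bad n σ → 2 ^ S * 2 ^ S * (2 ^ S * 2 ^ S) ≤ weight (3 * r ∸ 3) S σ
  Bad⇒weight≥ {σ} (l , logCube , i , j , _ , _ , clᵢ , clⱼ , diff , divides a refl , divides c refl) = begin
    2 ^ S * 2 ^ S * (2 ^ S * 2 ^ S)
      ≤⟨ *-mono-≤ (*-mono-≤ (2^S≤μ* a≥1 (lg≤S a≤n)) (2^S≤μ* c≥1 (lg≤S c≤n))) (2^S*2^S≤ν* l≥1 U≤lg[l] (lg≤S l≤n)) ⟩
    μ S a * a * (μ S c * c) * (ν U S l * (l * l))
      ≡⟨ rearrange (μ S a) a (μ S c) c (ν U S l) l ⟩
    ν U S l * (μ S a * (μ S c * (a * l * (c * l))))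
      ≤⟨ *-monoʳ-≤ (ν U S l) (*-monoʳ-≤ (μ S a) (*-monoʳ-≤ (μ S c) (*≤pairsOnCycles σ clᵢ clⱼ diff))) ⟩
    ν U S l * (μ S a * (μ S c * pairsOnCycles σ (a * l) (c * l)))
      ≤⟨ term≤weight U S σ a≤n c≤n l≤n ⟩
    weight U S σ
      ∎
    where
    open ≤-Reasoning
    al≤n : a * l ≤ n
    al≤n = subst (_≤ n) (sym (CycleLength⇒≡ σ clᵢ)) (cycleLength≤n σ i)
    cl≤n : c * l ≤ n
    cl≤n = subst (_≤ n) (sym (CycleLength⇒≡ σ clⱼ)) (cycleLength≤n σ j)
    a≥1 : 1 ≤ a
    a≥1 = >-nonZero⁻¹ a {{m*n≢0⇒m≢0 a {{>-nonZero (proj₁ clᵢ)}}}}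
    l≥1 : 1 ≤ l
    l≥1 = >-nonZero⁻¹ l {{m*n≢0⇒n≢0 a {{>-nonZero (proj₁ clᵢ)}}}}
    c≥1 : 1 ≤ c
    c≥1 = >-nonZero⁻¹ c {{m*n≢0⇒m≢0 c {{>-nonZero (proj₁ clⱼ)}}}}
    a≤n = ≤-trans (m≤m*n a l {{>-nonZero l≥1}}) al≤n
    l≤n = ≤-trans (m≤n*m l a {{>-nonZero a≥1}}) al≤n
    c≤n = ≤-trans (m≤m*n c l {{>-nonZero l≥1}}) cl≤n
    lg≤S : ∀ {x} → x ≤ n → lg x ≤ S
    lg≤S x≤n = <2^⇒lg≤ (≤-<-trans x≤n n<2^S⁺)
    U≤lg[l] : U ≤ lg l
    U≤lg[l] = 2^≤⇒≤lg {j = U} (<⇒≤ (2^[3r∸3]<l {r = r} {S ∸ 1} {l} (≤-trans (s≤s z≤n) r≥2) 2^r≤S∸1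
                                     (LogCubeLt⇒[S∸1]^3<8* {l = l} {S} 2^S≤n logCube)))
    rearrange : ∀ μa a μc c νl l → μa * a * (μc * c) * (νl * (l * l)) ≡ νl * (μa * (μc * (a * l * (c * l))))
    rearrange = solve-∀

  length*2^U≤ : ∀ {L} → AllPairs Distinct L → All (Bad n) L →
    length L * 2 ^ (3 * r ∸ 3) ≤ 2 * (suc (suc S) * suc (suc S)) * n !
  length*2^U≤ {L} distinct bad = *-cancelˡ-≤ T {{T≢0}} (begin
    T * (length L * 2 ^ U)                      ≡⟨ rearrange T (length L) (2 ^ U) ⟩
    length L * T * 2 ^ U                        ≤⟨ *-monoˡ-≤ (2 ^ U) (length*≤∑𝔖 (weight U S) (weight-resp-≈ U S) L distinct
                                                                                (All.map Bad⇒weight≥ bad)) ⟩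
    ∑𝔖 n (weight U S) * 2 ^ U                   ≤⟨ *-monoˡ-≤ (2 ^ U) (∑𝔖-weight-≤ {n} U S) ⟩
    Mν * (Mμ * (Mμ * n !)) * 2 ^ U              ≡⟨ rearrange′ Mν (Mμ * (Mμ * n !)) (2 ^ U) ⟩
    Mν * 2 ^ U * (Mμ * (Mμ * n !))              ≤⟨ *-mono-≤ ∑ν≤ (*-mono-≤ ∑μ≤ (*-monoˡ-≤ (n !) ∑μ≤)) ⟩
    2 ^ S * 2 ^ suc S * (Y * (Y * n !))         ≡⟨ rearrange″ (2 ^ S) (suc (suc S)) (n !) ⟩
    T * (2 * (suc (suc S) * suc (suc S)) * n !) ∎)
    where
    open ≤-Reasoning
    T = 2 ^ S * 2 ^ S * (2 ^ S * 2 ^ S)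
    Y = suc (suc S) * 2 ^ S
    Mμ = ∑[ a < suc n ] μ S (toℕ a)
    Mν = ∑[ l < suc n ] ν U S (toℕ l)
    T≢0 : NonZero T
    T≢0 = m*n≢0 (2 ^ S * 2 ^ S) (2 ^ S * 2 ^ S) {{2^2S≢0}} {{2^2S≢0}}
      where 2^2S≢0 = m*n≢0 (2 ^ S) (2 ^ S) {{m^n≢0 2 S}} {{m^n≢0 2 S}}
    ∑μ≤ : Mμ ≤ Y
    ∑μ≤ = ≤-trans (∑-toℕ-mono (μ S) n<2^S⁺) (≤-reflexive (∑μ S))
    ∑ν≤ : Mν * 2 ^ U ≤ 2 ^ S * 2 ^ suc S
    ∑ν≤ = ≤-trans (*-monoˡ-≤ (2 ^ U) (∑-toℕ-mono (ν U S) n<2^S⁺)) (∑ν S U≥1)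
      where
      U≥1 : 1 ≤ U
      U≥1 = ≤-trans (s≤s z≤n) (∸-monoˡ-≤ 3 (*-monoʳ-≤ 3 r≥2))
    rearrange : ∀ t l u → t * (l * u) ≡ l * t * u
    rearrange = solve-∀
    rearrange′ : ∀ a m u → a * m * u ≡ a * u * m
    rearrange′ = solve-∀
    rearrange″ : ∀ p s f → p * (2 * p) * (s * p * (s * p * f)) ≡ p * p * (p * p) * (2 * (s * s) * f)
    rearrange″ = solve-∀

threshold : ∀ b S r → b + 8 ≤ r → S ∸ 1 < 2 ^ suc r → suc b * (2 * (suc (suc S) * suc (suc S))) ≤ 2 ^ (3 * r ∸ 3)
threshold b S r b+8≤r S∸1<2^r⁺ = begin
  suc b * (2 * (suc (suc S) * suc (suc S)))                  ≤⟨ *-mono-≤ (n<2^n b) (*-monoʳ-≤ 2 (*-mono-≤ S+2≤ S+2≤)) ⟩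
  2 ^ b * (2 * (2 ^ suc (suc r) * 2 ^ suc (suc r)))          ≡⟨ cong (λ k → 2 ^ b * (2 * k)) (^-distribˡ-+-* 2 (suc (suc r)) (suc (suc r))) ⟨
  2 ^ b * 2 ^ suc (suc (suc r) + suc (suc r))                ≡⟨ ^-distribˡ-+-* 2 b _ ⟨
  2 ^ (b + suc (suc (suc r) + suc (suc r)))                  ≤⟨ ^-monoʳ-≤ 2 exponent ⟩
  2 ^ (3 * r ∸ 3)                                            ∎
  where
  open ≤-Reasoning
  S+2≤ : suc (suc S) ≤ 2 ^ suc (suc r)
  S+2≤ = begin
    suc (suc S)                ≡⟨ +-comm 2 S ⟩
    S + 2                      ≤⟨ +-mono-≤ (≤-trans (m≤suc[m∸1] S) S∸1<2^r⁺) (*-monoʳ-≤ 2 (m^n>0 2 r)) ⟩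
    2 ^ suc r + 2 ^ suc r      ≡⟨ cong (2 ^ suc r +_) (+-identityʳ (2 ^ suc r)) ⟨
    2 ^ suc (suc r)            ∎
    where
    m≤suc[m∸1] : ∀ m → m ≤ suc (m ∸ 1)
    m≤suc[m∸1] zero    = z≤n
    m≤suc[m∸1] (suc m) = ≤-refl
  exponent : b + suc (suc (suc r) + suc (suc r)) ≤ 3 * r ∸ 3
  exponent = subst (λ r → b + suc (suc (suc r) + suc (suc r)) ≤ 3 * r ∸ 3) (m+[n∸m]≡n b+8≤r) (begin
    b + suc (suc (suc (b + 8 + t)) + suc (suc (b + 8 + t)))  ≡⟨ e₁ b t ⟩
    3 * b + 21 + 2 * t                                       ≤⟨ m≤m+n _ t ⟩
    3 * b + 21 + 2 * t + t                                   ≡⟨ m+n∸m≡n 3 _ ⟨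
    3 + (3 * b + 21 + 2 * t + t) ∸ 3                         ≡⟨ cong (_∸ 3) (e₂ b t) ⟨
    3 * (b + 8 + t) ∸ 3                                      ∎)
    where
    t = r ∸ (b + 8)
    e₁ : ∀ b t → b + suc (suc (suc (b + 8 + t)) + suc (suc (b + 8 + t))) ≡ 3 * b + 21 + 2 * t
    e₁ = solve-∀
    e₂ : ∀ b t → 3 * (b + 8 + t) ≡ 3 + (3 * b + 21 + 2 * t + t)
    e₂ = solve-∀

-- lg is ⌊log₂⌋; with these S and r, every l > log³ n exceeds 2^(3r ∸ 3) (LogCubeLt⇒[S∸1]^3<8*).
module Scales (b : ℕ) {n : ℕ} (N≤n : 2 ^ (2 ^ (b + 8) + 1) ≤ n) where

  S = lg n
  r = lg (S ∸ 1)

  2^S≤n : 2 ^ S ≤ n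
  2^S≤n = proj₁ (lg-spec n (≤-trans (m^n>0 2 (2 ^ (b + 8) + 1)) N≤n))

  n<2^S⁺ : n < 2 ^ suc S
  n<2^S⁺ = proj₂ (lg-spec n (≤-trans (m^n>0 2 (2 ^ (b + 8) + 1)) N≤n))

  private
    2^[b+8]≤S∸1 : 2 ^ (b + 8) ≤ S ∸ 1
    2^[b+8]≤S∸1 = subst (_≤ S ∸ 1) (m+n∸n≡m (2 ^ (b + 8)) 1) (∸-monoˡ-≤ 1 (2^≤⇒≤lg {j = 2 ^ (b + 8) + 1} N≤n))

  2^r≤S∸1 : 2 ^ r ≤ S ∸ 1
  2^r≤S∸1 = proj₁ (lg-spec (S ∸ 1) (≤-trans (m^n>0 2 (b + 8)) 2^[b+8]≤S∸1))

  S∸1<2^r⁺ : S ∸ 1 < 2 ^ suc r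
  S∸1<2^r⁺ = proj₂ (lg-spec (S ∸ 1) (≤-trans (m^n>0 2 (b + 8)) 2^[b+8]≤S∸1))

  b+8≤r : b + 8 ≤ r
  b+8≤r = 2^≤⇒≤lg {j = b + 8} 2^[b+8]≤S∸1

  r≥2 : 2 ≤ r
  r≥2 = ≤-trans (s≤s (s≤s z≤n)) (≤-trans (m≤n+m 8 b) b+8≤r)

lemma3 : (b : ℕ) → Σ ℕ λ N → (n : ℕ) → N ≤ n →
    (L : List (Permutation′ n)) → AllPairs Distinct L → All (Bad n) L →
    length L * suc b ≤ n !
lemma3 b = 2 ^ (2 ^ (b + 8) + 1) , λ n N≤n L distinct bad → let open Scales b N≤n; Z = 2 * (suc (suc S) * suc (suc S)) in
  *-cancelʳ-≤ (length L * suc b) (n !) Z (begin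
    length L * suc b * Z          ≡⟨ *-assoc (length L) (suc b) Z ⟩
    length L * (suc b * Z)        ≤⟨ *-monoʳ-≤ (length L) (threshold b S r b+8≤r S∸1<2^r⁺) ⟩
    length L * 2 ^ (3 * r ∸ 3)    ≤⟨ length*2^U≤ {n} {S} {r} 2^S≤n n<2^S⁺ r≥2 2^r≤S∸1 distinct bad ⟩
    Z * n !                       ≡⟨ *-comm Z (n !) ⟩
    n ! * Z                       ∎)
  where open ≤-Reasoning
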